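{- For every $k\in\mathbb{N}$ and $K>0$ there is $K'>0$ depending only on $k,K$ such that the following holds. Let $f_1,f_2:\{ -1,1\}^n\to\{ -1,1\}$ be increasing with $\mathrm{Cov}(f_1,f_2)\le K\,\varphi(W_1(f_1,f_2))$, and let $g_1,\dots,g_n$ be weighted majority functions with at most $k$ layers, on pairwise disjoint sets of variables. Then for $\tilde f_\ell=f_\ell\circ(g_1,\dots,g_n)$, $\ell=1,2$, we have $\mathrm{Cov}(\tilde f_1,\tilde f_2)\le K'\,\varphi(W_1(\tilde f_1,\tilde f_2))$.
   Context: Domains are $\{ -1,1\}^N$ with uniform measure and coordinatewise order; increasing means non-decreasing. $\mathrm{Cov}(f,g)=\mathbb{E}[fg]-\mathbb{E}[f]\mathbb{E}[g]$. For $h:\{ -1,1\}^N\to\{ -1,1\}$, $I_k(h)=\Pr_x[h(x)\ne h(x^{(k)})]$ where $x^{(k)}$ is $x$ with coordinate $k$ flipped, and $W_1(h_1,h_2)=\sum_k I_k(h_1)I_k(h_2)$. $\varphi(x)=x/\log(e/x)$, $\varphi(0)=0$. A linear threshold function is $h(x)=\mathrm{sign}(\sum_i a_ix_i-\theta)$ ($\mathrm{sign}(t)=1$ if $t\ge0$, else $-1$). A 1-layer weighted majority function is an increasing balanced ($\mathbb{E}[h]=0$) linear threshold function on any number of coordinates (including one). A $k$-layer weighted majority function is $f\circ(h_1,\dots,h_m)$ where $f:\{ -1,1\}^m\to\{ -1,1\}$ is an increasing balanced linear threshold function and $h_1,\dots,h_m$ are $(k-1)$-layer weighted majority functions on disjoint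 sets of variables. Composition: $f\circ(g_1,\dots,g_n)(x^1,\dots,x^n)=f(g_1(x^1),\dots,g_n(x^n))$.
   Formalization: The constant K ranges over the positive rationals, and the weights $a_i$ and threshold θ of the linear threshold functions are rational rather than real. -}

module Defs where

open import Data.Bool using (Bool; true; false; not; if_then_else_)
import Data.Bool as B
open import Data.Nat as ℕ using (ℕ; zero; suc)
open import Data.Integer using (+_)
open import Data.Fin using (Fin)
open import Data.Fin.Permutation using (Permutation; _⟨$⟩ʳ_)
open import Data.Vec using (Vec; []; _∷_; lookup; tabulate; splitAt; sum; updateAt; toList)
open import Data.Vec.Relation.Binary.Pointwise.Inductive using (Pointwise)
open import Data.List using (List; []; _∷_; map; foldr; _++_; length; filter; allFin)
open import Data.Product using (Σ; _×_; _,_; ∃)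
open import Data.Sum using (_⊎_)
open import Relation.Binary.PropositionalEquality using (_≡_; _≢_)
open import Relation.Nullary using (¬_)
open import Data.Rational using (ℚ; 0ℚ; 1ℚ; _+_; _*_; _-_; -_; _≤_; _<_; _/_; _÷_; _≤?_; >-nonZero; <-nonZero)
open import Relation.Nullary using (yes; no)
open import Data.Fin using (zero; suc)
open import Data.Nat.Properties using (m^n>0)

-- The Boolean cube {-1,1}^N, encoded as Vec Bool N (true ↔ +1, false ↔ -1).

Cube : ℕ → Set
Cube N = Vec Bool N

val : Bool → ℚ
val true  = 1ℚ
val false = - 1ℚ

allPoints : (N : ℕ) → List (Cube N)
allPoints zero    = [] ∷ []
allPoints (suc N) = map (true ∷_) (allPoints N) ++ map (false ∷_) (allPoints N)

sumℚ : List ℚ → ℚ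
sumℚ = foldr _+_ 0ℚ

invPow2 : ℕ → ℚ
invPow2 N = (+ 1 / (2 ℕ.^ N)) {{ℕ.>-nonZero (m^n>0 2 N)}}

E : {N : ℕ} → (Cube N → ℚ) → ℚ
E {N} F = sumℚ (map F (allPoints N)) * invPow2 N

BoolFun : ℕ → Set
BoolFun N = Cube N → Bool

Cov : {N : ℕ} → BoolFun N → BoolFun N → ℚ
Cov f g = E (λ x → val (f x) * val (g x)) - E (λ x → val (f x)) * E (λ x → val (g x))

flipAt : {N : ℕ} → Fin N → Cube N → Cube N
flipAt k x = updateAt x k not

differ : Bool → Bool → ℚ
differ true  true  = 0ℚ
differ false false = 0ℚ
differ _     _     = 1ℚ

Inf : {N : ℕ} → Fin N → BoolFun N → ℚ
Inf k h = E (λ x → differ (h x) (h (flipAt k x)))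

W1 : {N : ℕ} → BoolFun N → BoolFun N → ℚ
W1 {N} h₁ h₂ = sumℚ (map (λ k → Inf k h₁ * Inf k h₂) (allFin N))

_≤ᶜ_ : {N : ℕ} → Cube N → Cube N → Set
x ≤ᶜ y = Pointwise B._≤_ x y

Increasing : {N : ℕ} → BoolFun N → Set
Increasing h = ∀ x y → x ≤ᶜ y → h x B.≤ h y

Balanced : {N : ℕ} → BoolFun N → Set
Balanced h = E (λ x → val (h x)) ≡ 0ℚ

sign : ℚ → Bool
sign t with 0ℚ ≤? t
... | yes _ = true
... | no  _ = false

linForm : {N : ℕ} → Vec ℚ N → Cube N → ℚ
linForm []       []       = 0ℚ
linForm (a ∷ as) (b ∷ xs) = a * val b + linForm as xs

IsLTF : {N : ℕ} → BoolFun N → Set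
IsLTF {N} h = Σ (Vec ℚ N) λ a → Σ ℚ λ θ → ∀ x → h x ≡ sign (linForm a x - θ)

IsIBLTF : {N : ℕ} → BoolFun N → Set
IsIBLTF h = IsLTF h × Increasing h × Balanced h

-- Composition on disjoint blocks of variables:
-- (f ∘ (g_1,…,g_m))(x^1,…,x^m) = f(g_1(x^1),…,g_m(x^m)),
-- where the input of length Σ sizes is cut into consecutive blocks.

blocks : {m : ℕ} (sizes : Vec ℕ m) → Cube (sum sizes) → (i : Fin m) → Cube (lookup sizes i)
blocks (s ∷ ss) x zero    with splitAt s x
... | y , z , _ = y
blocks (s ∷ ss) x (suc i) with splitAt s x
... | y , z , _ = blocks ss z i

compose : {m : ℕ} → BoolFun m → (sizes : Vec ℕ m) →
          ((i : Fin m) → BoolFun (lookup sizes i)) → BoolFun (sum sizes)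
compose f sizes gs x = f (tabulate λ i → gs i (blocks sizes x i))

permuteInput : {M N : ℕ} → Permutation M N → Cube N → Cube M
permuteInput π x = tabulate λ j → lookup x (π ⟨$⟩ʳ j)

-- The disjoint variable sets of the inner functions may be arbitrary:
-- the blocks are placed in consecutive order after an arbitrary
-- permutation of the N variables.

data WM : ℕ → (N : ℕ) → BoolFun N → Set where
  layer1 : ∀ {N} {h : BoolFun N} → IsIBLTF h → WM 1 N h
  layerS : ∀ {k m N} {f : BoolFun m} (sizes : Vec ℕ m)
           (gs : (i : Fin m) → BoolFun (lookup sizes i))
           (π : Permutation (sum sizes) N) (h : BoolFun N) →
           IsIBLTF f →
           (∀ i → WM k (lookup sizes i) (gs i)) →
           (∀ x → h x ≡ compose f sizes gs (permuteInput π x)) →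
           WM (suc k) N h

WMAtMost : ℕ → (N : ℕ) → BoolFun N → Set
WMAtMost k N h = Σ ℕ λ j → j ℕ.≤ k × WM j N h

-- Exponential / logarithm comparisons with rationals, via the Taylor
-- partial sums S_N(r) = Σ_{j≤N} r^j/j!  (increasing to exp r for r ≥ 0).

expTerm : ℕ → ℚ → ℚ
expTerm zero    r = 1ℚ
expTerm (suc j) r = expTerm j r * r * (+ 1 / suc j)

expPartial : ℕ → ℚ → ℚ
expPartial zero    r = 1ℚ
expPartial (suc n) r = expPartial n r + expTerm (suc n) r

-- exp r ≤ w   (equivalently, for w > 0: r ≤ ln w)
ExpLe : ℚ → ℚ → Set
ExpLe r w =
  (0ℚ ≤ r → ∀ n → expPartial n r ≤ w) ×
  -- for r < 0:  exp r ≤ w  ⇔  w · exp(-r) ≥ 1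
  (r < 0ℚ → ∀ ε → 0ℚ < ε → ∃ λ n → 1ℚ - ε ≤ w * expPartial n (- r))

-- w < e
LtE : ℚ → Set
LtE w = ∃ λ n → w < expPartial n 1ℚ

-- e < w
GtE : ℚ → Set
GtE w = Σ ℚ λ ε → 0ℚ < ε × ∀ n → expPartial n 1ℚ + ε ≤ w

-- φ(x) = x / log(e/x), φ(0) = 0.
-- PhiBound K c w  means  c ≤ K · φ(w)   (for K > 0, w ≥ 0; w is never
-- negative in our use since W_1 ≥ 0).
-- For w > 0, with L = ln w (note L ≠ 1 since e is irrational):
--   * if w < e  (1 - L > 0):  c ≤ Kw/(1-L)  ⇔  c ≤ 0  or  (c > 0 and 1 - Kw/c ≤ L)
--   * if w > e  (1 - L < 0):  c ≤ Kw/(1-L)  ⇔  c < 0  and  1 - Kw/c ≤ L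

PhiBound : ℚ → ℚ → ℚ → Set
PhiBound K c w =
  (w ≤ 0ℚ → c ≤ 0ℚ) ×
  (0ℚ < w → LtE w →
     c ≤ 0ℚ ⊎ Σ (0ℚ < c) (λ p → ExpLe (1ℚ - (K * w ÷ c) {{>-nonZero p}}) w)) ×
  (GtE w →
     Σ (c < 0ℚ) (λ p → ExpLe (1ℚ - (K * w ÷ c) {{<-nonZero p}}) w))

{-# OPTIONS --safe #-}

-- Balanced inner functions push the uniform measure on the variables forward to the uniform
-- measure on {-1,1}ⁿ, so composing with the gᵢ leaves Cov(f₁,f₂) unchanged, while influences
-- multiply along the composition: W₁(f̃₁,f̃₂) = Σᵢ Iᵢ(f₁) W₁(gᵢ,gᵢ) Iᵢ(f₂).
-- For increasing h, Iⱼ(h) is the Fourier coefficient ĥ({j}), so Bessel's inequality gives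
-- W₁(h,h) ≤ 1; for a balanced increasing threshold function sign(a·x − θ), comparing the first,
-- second and fourth moments of a·x − θ and applying Cauchy–Schwarz gives W₁(h,h) ≥ 1/6.
-- By induction on the layers 6⁻ᵏ ≤ W₁(gᵢ,gᵢ) ≤ 1, hence W₁(f̃₁,f̃₂) ≤ W₁(f₁,f₂) ≤ 6ᵏ W₁(f̃₁,f̃₂).
-- Finally φ(w) = w / (1 − ln w) satisfies φ(w) ≤ (1 + b)² φ(w̃) whenever w̃ ≤ w ≤ 1 and
-- w ≤ (1 + b) w̃, which transfers the bound with K′ = K (1 + 6ᵏ)².

module Submission where

open import Defs
open import Data.Nat using (ℕ)
open import Data.Fin using (Fin)
open import Data.Vec using (Vec; lookup)
open import Data.Product using (Σ; _×_)
open import Data.Rational using (ℚ; 0ℚ; _<_)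

open import Data.Bool as Bool using (Bool; true; false; not; f≤t; b≤b)
open import Data.Empty using (⊥; ⊥-elim)
open import Data.Fin as Fin using (zero; suc; _↑ˡ_; _↑ʳ_)
import Data.Fin.Properties as Finₚ
open import Data.Fin.Permutation using (Permutation; _⟨$⟩ʳ_; _⟨$⟩ˡ_; inverseˡ; inverseʳ; ↔⇒≡)
open import Data.Integer as ℤ using ()
open import Data.List as List using (List; []; _∷_; map; allFin)
import Data.List.Properties as Listₚ
open import Data.Nat as ℕ using (z≤n; s≤s)
open import Data.Nat.Properties as ℕₚ using (m^n>0)
open import Data.Product using (_,_; proj₁; proj₂; ∃)
open import Data.Rational hiding (ℚ; 0ℚ; _<_)
open import Data.Rational.Properties
import Data.Rational.Unnormalised as ℚᵘ
import Data.Rational.Unnormalised.Properties as ℚᵘₚ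
open import Data.Rational.Solver using (module +-*-Solver)
open import Data.Sum using (_⊎_; inj₁; inj₂)
open import Data.Vec as Vec using ([]; _∷_; _++_; tabulate; updateAt)
import Data.Vec.Properties as Vecₚ
open import Data.Vec.Relation.Binary.Pointwise.Inductive as Pointwise using (_∷_)
open import Function using (_∘_)
open import Relation.Binary.Definitions using (DecidableEquality; tri<; tri≈; tri>)
open import Relation.Binary.PropositionalEquality
open import Relation.Nullary using (yes; no)

open +-*-Solver

0≤p*q : ∀ {p q} → 0ℚ ≤ p → 0ℚ ≤ q → 0ℚ ≤ p * q
0≤p*q {p} {q} 0≤p 0≤q =
  nonNegative⁻¹ _ {{nonNeg*nonNeg⇒nonNeg p {{nonNegative 0≤p}} q {{nonNegative 0≤q}}}}

0<p*q : ∀ {p q} → 0ℚ < p → 0ℚ < q → 0ℚ < p * q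
0<p*q {p} {q} 0<p 0<q = positive⁻¹ _ {{pos*pos⇒pos p {{positive 0<p}} q {{positive 0<q}}}}

0≤p*p : ∀ p → 0ℚ ≤ p * p
0≤p*p p with ≤-total 0ℚ p
... | inj₁ 0≤p = 0≤p*q 0≤p 0≤p
... | inj₂ p≤0 = nonNegative⁻¹ _ {{nonPos*nonPos⇒nonPos p {{nonPositive p≤0}} p {{nonPositive p≤0}}}}

p*p≡0⇒p≡0 : ∀ p → p * p ≡ 0ℚ → p ≡ 0ℚ
p*p≡0⇒p≡0 p p*p≡0 with <-cmp p 0ℚ
... | tri≈ _ p≡0 _ = p≡0
... | tri< p<0 _ _ = ⊥-elim (<-irrefl (sym p*p≡0) (positive⁻¹ _ {{neg*neg⇒pos p {{negative p<0}} p {{negative p<0}}}}))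
... | tri> _ _ p>0 = ⊥-elim (<-irrefl (sym p*p≡0) (0<p*q p>0 p>0))

p+q≡0⇒p≡0 : ∀ {p q} → 0ℚ ≤ p → 0ℚ ≤ q → p + q ≡ 0ℚ → p ≡ 0ℚ
p+q≡0⇒p≡0 {p} {q} 0≤p 0≤q p+q≡0 =
  ≤-antisym (subst (p ≤_) p+q≡0 (subst (_≤ p + q) (+-identityʳ p) (+-monoʳ-≤ p 0≤q))) 0≤p

≤-fromDiff : ∀ {p q} r → 0ℚ ≤ r → q - p ≡ r → p ≤ q
≤-fromDiff {p} {q} r 0≤r q-p≡r = subst₂ _≤_ (+-identityʳ p) p+r≡q (+-monoʳ-≤ p 0≤r)
  where
  p+r≡q : p + r ≡ q
  p+r≡q = trans (cong (p +_) (sym q-p≡r)) (solve 2 (λ p q → p :+ (q :- p) := q) refl p q)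

<-fromDiff : ∀ {p q} r → 0ℚ < r → q - p ≡ r → p < q
<-fromDiff {p} {q} r 0<r q-p≡r = subst₂ _<_ (+-identityʳ p) p+r≡q (+-monoʳ-< p 0<r)
  where
  p+r≡q : p + r ≡ q
  p+r≡q = trans (cong (p +_) (sym q-p≡r)) (solve 2 (λ p q → p :+ (q :- p) := q) refl p q)

≤⇒0≤diff : ∀ {p q} → p ≤ q → 0ℚ ≤ q - p
≤⇒0≤diff {p} {q} p≤q = subst (_≤ q - p) (+-inverseʳ p) (+-monoˡ-≤ (- p) p≤q)

*-monoˡ-≤-0≤ : ∀ {r p q} → 0ℚ ≤ r → p ≤ q → r * p ≤ r * q
*-monoˡ-≤-0≤ {r} 0≤r = *-monoˡ-≤-nonNeg r {{nonNegative 0≤r}}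

*-monoʳ-≤-0≤ : ∀ {r p q} → 0ℚ ≤ r → p ≤ q → p * r ≤ q * r
*-monoʳ-≤-0≤ {r} 0≤r = *-monoʳ-≤-nonNeg r {{nonNegative 0≤r}}

<⇒≱ : ∀ {p q} → p < q → q ≤ p → ⊥
<⇒≱ p<q q≤p = <-irrefl refl (<-≤-trans p<q q≤p)

sumℚ-++ : ∀ (ps qs : List ℚ) → sumℚ (ps List.++ qs) ≡ sumℚ ps + sumℚ qs
sumℚ-++ []       qs = sym (+-identityˡ _)
sumℚ-++ (p ∷ ps) qs = trans (cong (p +_) (sumℚ-++ ps qs)) (sym (+-assoc p _ _))

module _ {A : Set} where

  sumℚ-map-cong : ∀ {F G : A → ℚ} xs → (∀ x → F x ≡ G x) → sumℚ (map F xs) ≡ sumℚ (map G xs)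
  sumℚ-map-cong xs F≗G = cong sumℚ (Listₚ.map-cong F≗G xs)

  sumℚ-map-+ : ∀ (F G : A → ℚ) xs →
               sumℚ (map (λ x → F x + G x) xs) ≡ sumℚ (map F xs) + sumℚ (map G xs)
  sumℚ-map-+ F G []       = refl
  sumℚ-map-+ F G (x ∷ xs) rewrite sumℚ-map-+ F G xs =
    solve 4 (λ a b c d → (a :+ b) :+ (c :+ d) := (a :+ c) :+ (b :+ d)) refl
      (F x) (G x) (sumℚ (map F xs)) (sumℚ (map G xs))

  sumℚ-map-*ˡ : ∀ c (F : A → ℚ) xs → sumℚ (map (λ x → c * F x) xs) ≡ c * sumℚ (map F xs)
  sumℚ-map-*ˡ c F []       = sym (*-zeroʳ c)
  sumℚ-map-*ˡ c F (x ∷ xs) rewrite sumℚ-map-*ˡ c F xs = sym (*-distribˡ-+ c (F x) _)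

  sumℚ-map-neg : ∀ (F : A → ℚ) xs → sumℚ (map (λ x → - F x) xs) ≡ - sumℚ (map F xs)
  sumℚ-map-neg F []       = refl
  sumℚ-map-neg F (x ∷ xs) rewrite sumℚ-map-neg F xs = sym (neg-distrib-+ (F x) _)

  sumℚ-map-0 : ∀ (xs : List A) → sumℚ (map (λ _ → 0ℚ) xs) ≡ 0ℚ
  sumℚ-map-0 []       = refl
  sumℚ-map-0 (x ∷ xs) rewrite sumℚ-map-0 xs = refl

  sumℚ-map-mono : ∀ {F G : A → ℚ} xs → (∀ x → F x ≤ G x) → sumℚ (map F xs) ≤ sumℚ (map G xs)
  sumℚ-map-mono []       F≤G = ≤-refl
  sumℚ-map-mono (x ∷ xs) F≤G = +-mono-≤ (F≤G x) (sumℚ-map-mono xs F≤G)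

  sumℚ-map-nonNeg : ∀ {F : A → ℚ} xs → (∀ x → 0ℚ ≤ F x) → 0ℚ ≤ sumℚ (map F xs)
  sumℚ-map-nonNeg {F} xs 0≤F = subst (_≤ sumℚ (map F xs)) (sumℚ-map-0 xs) (sumℚ-map-mono xs 0≤F)

sumℚ-map-∘ : ∀ {A B : Set} (F : B → ℚ) (g : A → B) xs →
             sumℚ (map F (map g xs)) ≡ sumℚ (map (F ∘ g) xs)
sumℚ-map-∘ F g xs = cong sumℚ (sym (Listₚ.map-∘ xs))

sumℚ-allFin-suc : ∀ n (F : Fin (ℕ.suc n) → ℚ) →
                  sumℚ (map F (allFin (ℕ.suc n))) ≡ F zero + sumℚ (map (F ∘ suc) (allFin n))
sumℚ-allFin-suc n F =
  cong (F zero +_) (cong sumℚ (trans (Listₚ.map-tabulate suc F) (sym (Listₚ.map-tabulate (λ j → j) (F ∘ suc)))))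

sumℚ-allFin-+ : ∀ m n (F : Fin (m ℕ.+ n) → ℚ) →
                sumℚ (map F (allFin (m ℕ.+ n))) ≡
                sumℚ (map (λ j → F (j ↑ˡ n)) (allFin m)) + sumℚ (map (λ k → F (m ↑ʳ k)) (allFin n))
sumℚ-allFin-+ ℕ.zero    n F = sym (+-identityˡ _)
sumℚ-allFin-+ (ℕ.suc m) n F = begin
  sumℚ (map F (allFin (ℕ.suc m ℕ.+ n)))
    ≡⟨ sumℚ-allFin-suc (m ℕ.+ n) F ⟩
  F zero + sumℚ (map (F ∘ suc) (allFin (m ℕ.+ n)))
    ≡⟨ cong (F zero +_) (sumℚ-allFin-+ m n (F ∘ suc)) ⟩
  F zero + (sumℚ (map (λ j → F (suc j ↑ˡ n)) (allFin m)) + right)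
    ≡⟨ sym (+-assoc (F zero) _ right) ⟩
  F zero + sumℚ (map (λ j → F (suc j ↑ˡ n)) (allFin m)) + right
    ≡⟨ cong (_+ right) (sym (sumℚ-allFin-suc m (λ j → F (j ↑ˡ n)))) ⟩
  sumℚ (map (λ j → F (j ↑ˡ n)) (allFin (ℕ.suc m))) + right ∎
  where
  open ≡-Reasoning
  right = sumℚ (map (λ k → F (ℕ.suc m ↑ʳ k)) (allFin n))

invPow2-suc : ∀ N → invPow2 (ℕ.suc N) ≡ ½ * invPow2 N
invPow2-suc N = half (2 ℕ.^ N) {{ℕ.>-nonZero (m^n>0 2 N)}} {{ℕ.>-nonZero (m^n>0 2 (ℕ.suc N))}}
  where
  half : ∀ m .{{_ : ℕ.NonZero m}} .{{_ : ℕ.NonZero (2 ℕ.* m)}} →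
         ℤ.+ 1 / (2 ℕ.* m) ≡ ½ * (ℤ.+ 1 / m)
  half (ℕ.suc k) = toℚᵘ-injective (ℚᵘₚ.≃-trans
    (toℚᵘ-fromℚᵘ (ℚᵘ.mkℚᵘ (ℤ.+ 1) (k ℕ.+ ℕ.suc (k ℕ.+ 0))))
    (ℚᵘₚ.≃-trans (ℚᵘ.*≡* refl) (ℚᵘₚ.≃-sym (ℚᵘₚ.≃-trans (toℚᵘ-homo-* ½ (ℤ.+ 1 / ℕ.suc k))
      (ℚᵘₚ.*-cong (ℚᵘₚ.≃-refl {ℚᵘ.mkℚᵘ (ℤ.+ 1) 1}) (toℚᵘ-fromℚᵘ (ℚᵘ.mkℚᵘ (ℤ.+ 1) k)))))))

0≤invPow2 : ∀ N → 0ℚ ≤ invPow2 N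
0≤invPow2 ℕ.zero    = nonNegative⁻¹ 1ℚ
0≤invPow2 (ℕ.suc N) rewrite invPow2-suc N = 0≤p*q (nonNegative⁻¹ ½) (0≤invPow2 N)

module _ {N : ℕ} where

  E-cong : ∀ {F G : Cube N → ℚ} → (∀ x → F x ≡ G x) → E F ≡ E G
  E-cong F≗G = cong (_* invPow2 N) (sumℚ-map-cong (allPoints N) F≗G)

  E-+ : ∀ (F G : Cube N → ℚ) → E (λ x → F x + G x) ≡ E F + E G
  E-+ F G rewrite sumℚ-map-+ F G (allPoints N) =
    *-distribʳ-+ (invPow2 N) (sumℚ (map F (allPoints N))) (sumℚ (map G (allPoints N)))

  E-*ˡ : ∀ c (F : Cube N → ℚ) → E (λ x → c * F x) ≡ c * E F
  E-*ˡ c F rewrite sumℚ-map-*ˡ c F (allPoints N) = *-assoc c (sumℚ (map F (allPoints N))) (invPow2 N)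

  E-neg : ∀ (F : Cube N → ℚ) → E (λ x → - F x) ≡ - E F
  E-neg F rewrite sumℚ-map-neg F (allPoints N) =
    sym (neg-distribˡ-* (sumℚ (map F (allPoints N))) (invPow2 N))

  E-sub : ∀ (F G : Cube N → ℚ) → E (λ x → F x - G x) ≡ E F - E G
  E-sub F G = trans (E-+ F (λ x → - G x)) (cong (E F +_) (E-neg G))

  E-*+ : ∀ c (F G : Cube N → ℚ) → E (λ x → c * F x + G x) ≡ c * E F + E G
  E-*+ c F G = trans (E-+ (λ x → c * F x) G) (cong (_+ E G) (E-*ˡ c F))

  E-mono : ∀ {F G : Cube N → ℚ} → (∀ x → F x ≤ G x) → E F ≤ E G
  E-mono F≤G = *-monoʳ-≤-0≤ (0≤invPow2 N) (sumℚ-map-mono (allPoints N) F≤G)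

E-[] : (F : Cube 0 → ℚ) → E F ≡ F []
E-[] F = solve 1 (λ a → (a :+ con 0ℚ) :* con 1ℚ := a) refl (F [])

E-∷ : ∀ {N} (F : Cube (ℕ.suc N) → ℚ) →
      E F ≡ ½ * (E (λ y → F (true ∷ y)) + E (λ y → F (false ∷ y)))
E-∷ {N} F
  rewrite Listₚ.map-++ F (map (true ∷_) (allPoints N)) (map (false ∷_) (allPoints N))
        | sumℚ-++ (map F (map (true ∷_) (allPoints N))) (map F (map (false ∷_) (allPoints N)))
        | sumℚ-map-∘ F (true ∷_) (allPoints N)
        | sumℚ-map-∘ F (false ∷_) (allPoints N)
        | invPow2-suc N
  = solve 3 (λ a b i → (a :+ b) :* (con ½ :* i) := con ½ :* (a :* i :+ b :* i)) refl
      (sumℚ (map (λ y → F (true ∷ y)) (allPoints N)))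
      (sumℚ (map (λ y → F (false ∷ y)) (allPoints N)))
      (invPow2 N)

E-const : ∀ N c → E {N} (λ _ → c) ≡ c
E-const ℕ.zero    c = E-[] (λ _ → c)
E-const (ℕ.suc N) c rewrite E-∷ {N} (λ _ → c) | E-const N c =
  solve 1 (λ c → con ½ :* (c :+ c) := c) refl c

E-nonNeg : ∀ {N} {F : Cube N → ℚ} → (∀ x → 0ℚ ≤ F x) → 0ℚ ≤ E F
E-nonNeg {N} {F} 0≤F = subst (_≤ E F) (E-const N 0ℚ) (E-mono 0≤F)

E-++ : ∀ m n (F : Cube (m ℕ.+ n) → ℚ) → E F ≡ E {m} (λ y → E {n} (λ z → F (y ++ z)))
E-++ ℕ.zero    n F = sym (E-[] (λ y → E {n} (λ z → F (y ++ z))))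
E-++ (ℕ.suc m) n F
  rewrite E-∷ F | E-++ m n (λ y → F (true ∷ y)) | E-++ m n (λ y → F (false ∷ y)) =
  sym (E-∷ {m} (λ y → E {n} (λ z → F (y ++ z))))

-- Influences

differ-sym : ∀ a b → differ a b ≡ differ b a
differ-sym false false = refl
differ-sym false true  = refl
differ-sym true  false = refl
differ-sym true  true  = refl

differ-refl : ∀ a → differ a a ≡ 0ℚ
differ-refl true  = refl
differ-refl false = refl

0≤differ : ∀ a b → 0ℚ ≤ differ a b
0≤differ true  true  = ≤-refl
0≤differ false false = ≤-refl
0≤differ true  false = nonNegative⁻¹ 1ℚ
0≤differ false true  = nonNegative⁻¹ 1ℚ

differ-≥ : ∀ a b → b Bool.≤ a → differ a b ≡ ½ * (val a - val b)
differ-≥ true  true  _ = refl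
differ-≥ true  false _ = refl
differ-≥ false false _ = refl

val*val : ∀ b → val b * val b ≡ 1ℚ
val*val true  = refl
val*val false = refl

0≤Inf : ∀ {N} (j : Fin N) h → 0ℚ ≤ Inf j h
0≤Inf j h = E-nonNeg (λ x → 0≤differ (h x) (h (flipAt j x)))

restrict : ∀ {N} → Bool → BoolFun (ℕ.suc N) → BoolFun N
restrict b h y = h (b ∷ y)

Increasing-restrict : ∀ {N} b (h : BoolFun (ℕ.suc N)) → Increasing h → Increasing (restrict b h)
Increasing-restrict b h inc x y x≤y = inc (b ∷ x) (b ∷ y) (b≤b ∷ x≤y)

Inf-zero : ∀ {N} (h : BoolFun (ℕ.suc N)) →
           Inf zero h ≡ E (λ y → differ (h (true ∷ y)) (h (false ∷ y)))
Inf-zero h = begin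
  Inf zero h
    ≡⟨ E-∷ (λ x → differ (h x) (h (flipAt zero x))) ⟩
  ½ * (D + E (λ y → differ (h (false ∷ y)) (h (true ∷ y))))
    ≡⟨ cong (λ d → ½ * (D + d)) (E-cong (λ y → differ-sym (h (false ∷ y)) (h (true ∷ y)))) ⟩
  ½ * (D + D)
    ≡⟨ solve 1 (λ d → con ½ :* (d :+ d) := d) refl D ⟩
  D ∎
  where
  open ≡-Reasoning
  D = E (λ y → differ (h (true ∷ y)) (h (false ∷ y)))

Inf-suc : ∀ {N} (j : Fin N) (h : BoolFun (ℕ.suc N)) →
          Inf (suc j) h ≡ ½ * (Inf j (restrict true h) + Inf j (restrict false h))
Inf-suc j h = E-∷ (λ x → differ (h x) (h (flipAt (suc j) x)))

Inf-zero-increasing : ∀ {N} (h : BoolFun (ℕ.suc N)) → Increasing h →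
  Inf zero h ≡ ½ * (E (λ y → val (h (true ∷ y))) - E (λ y → val (h (false ∷ y))))
Inf-zero-increasing h inc = begin
  Inf zero h
    ≡⟨ Inf-zero h ⟩
  E (λ y → differ (h (true ∷ y)) (h (false ∷ y)))
    ≡⟨ E-cong (λ y → differ-≥ _ _ (inc (false ∷ y) (true ∷ y) (f≤t ∷ Pointwise.refl b≤b))) ⟩
  E (λ y → ½ * (val (h (true ∷ y)) - val (h (false ∷ y))))
    ≡⟨ E-*ˡ ½ (λ y → val (h (true ∷ y)) - val (h (false ∷ y))) ⟩
  ½ * E (λ y → val (h (true ∷ y)) - val (h (false ∷ y)))
    ≡⟨ cong (½ *_) (E-sub (λ y → val (h (true ∷ y))) (λ y → val (h (false ∷ y)))) ⟩
  ½ * (E (λ y → val (h (true ∷ y))) - E (λ y → val (h (false ∷ y)))) ∎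
  where open ≡-Reasoning

E-∘-balanced : ∀ {N} (g : BoolFun N) → Balanced g → ∀ (Ψ : Bool → ℚ) →
               E (λ x → Ψ (g x)) ≡ ½ * (Ψ true + Ψ false)
E-∘-balanced {N} g bal Ψ = begin
  E (λ x → Ψ (g x))              ≡⟨ E-cong (λ x → affine (g x)) ⟩
  E (λ x → c * val (g x) + m)    ≡⟨ E-*+ c (λ x → val (g x)) (λ _ → m) ⟩
  c * E (λ x → val (g x)) + E {N} (λ _ → m)
                                 ≡⟨ cong₂ (λ e e′ → c * e + e′) bal (E-const N m) ⟩
  c * 0ℚ + m                     ≡⟨ solve 2 (λ c m → c :* con 0ℚ :+ m := m) refl c m ⟩
  m                              ∎
  where
  open ≡-Reasoning
  m = ½ * (Ψ true + Ψ false)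
  c = ½ * (Ψ true - Ψ false)
  affine : ∀ b → Ψ b ≡ c * val b + m
  affine true  = solve 2 (λ t f → t := con ½ :* (t :- f) :* con 1ℚ :+ con ½ :* (t :+ f)) refl
                   (Ψ true) (Ψ false)
  affine false = solve 2 (λ t f → f := con ½ :* (t :- f) :* con (- 1ℚ) :+ con ½ :* (t :+ f)) refl
                   (Ψ true) (Ψ false)

-- Reindexing sums along bijections

module _ {A : Set} (_≟_ : DecidableEquality A) where

  δ : A → A → ℚ
  δ a b with a ≟ b
  ... | yes _ = 1ℚ
  ... | no  _ = 0ℚ

  δ-≡ : ∀ {a b} → a ≡ b → δ a b ≡ 1ℚ
  δ-≡ {a} {b} a≡b with a ≟ b
  ... | yes _   = refl
  ... | no  a≢b = ⊥-elim (a≢b a≡b)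

  δ-≢ : ∀ {a b} → a ≢ b → δ a b ≡ 0ℚ
  δ-≢ {a} {b} a≢b with a ≟ b
  ... | yes a≡b = ⊥-elim (a≢b a≡b)
  ... | no  _   = refl

  δ-*-at : ∀ a b (G : A → ℚ) → δ a b * G b ≡ G a * δ a b
  δ-*-at a b G with a ≟ b
  ... | yes refl = *-comm 1ℚ (G a)
  ... | no  _    = trans (*-zeroˡ (G b)) (sym (*-zeroʳ (G a)))

  Enumerates : List A → Set
  Enumerates xs = ∀ a → sumℚ (map (δ a) xs) ≡ 1ℚ

  sumℚ-δ-* : ∀ xs → Enumerates xs → ∀ (G : A → ℚ) a → sumℚ (map (λ b → δ a b * G b) xs) ≡ G a
  sumℚ-δ-* xs enum G a = begin
    sumℚ (map (λ b → δ a b * G b) xs) ≡⟨ sumℚ-map-cong xs (λ b → δ-*-at a b G) ⟩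
    sumℚ (map (λ b → G a * δ a b) xs) ≡⟨ sumℚ-map-*ˡ (G a) (δ a) xs ⟩
    G a * sumℚ (map (δ a) xs)         ≡⟨ cong (G a *_) (enum a) ⟩
    G a * 1ℚ                          ≡⟨ *-identityʳ (G a) ⟩
    G a                               ∎
    where open ≡-Reasoning

δ-cong : ∀ {A B : Set} (_≟ᴬ_ : DecidableEquality A) (_≟ᴮ_ : DecidableEquality B) {a b} {a′ b′} →
         (a ≡ b → a′ ≡ b′) → (a′ ≡ b′ → a ≡ b) → δ _≟ᴬ_ a b ≡ δ _≟ᴮ_ a′ b′
δ-cong _≟ᴬ_ _≟ᴮ_ {a} {b} to from with a ≟ᴬ b
... | yes a≡b = sym (δ-≡ _≟ᴮ_ (to a≡b))
... | no  a≢b = sym (δ-≢ _≟ᴮ_ (λ a′≡b′ → a≢b (from a′≡b′)))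

sumℚ-swap : ∀ {A B : Set} (xs : List A) (ys : List B) (H : A → B → ℚ) →
            sumℚ (map (λ a → sumℚ (map (H a) ys)) xs) ≡ sumℚ (map (λ b → sumℚ (map (λ a → H a b) xs)) ys)
sumℚ-swap []       ys H = sym (sumℚ-map-0 ys)
sumℚ-swap (x ∷ xs) ys H =
  trans (cong (sumℚ (map (H x) ys) +_) (sumℚ-swap xs ys H))
        (sym (sumℚ-map-+ (H x) (λ b → sumℚ (map (λ a → H a b) xs)) ys))

sumℚ-reindex : ∀ {A B : Set} (_≟ᴬ_ : DecidableEquality A) (_≟ᴮ_ : DecidableEquality B)
               (xs : List A) (ys : List B) → Enumerates _≟ᴬ_ xs → Enumerates _≟ᴮ_ ys →
               (σ : A → B) (τ : B → A) → (∀ a → τ (σ a) ≡ a) → (∀ b → σ (τ b) ≡ b) →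
               ∀ (F : B → ℚ) → sumℚ (map (F ∘ σ) xs) ≡ sumℚ (map F ys)
sumℚ-reindex _≟ᴬ_ _≟ᴮ_ xs ys enumᴬ enumᴮ σ τ τσ στ F = begin
  sumℚ (map (F ∘ σ) xs)
    ≡⟨ sumℚ-map-cong xs (λ a → sym (sumℚ-δ-* _≟ᴮ_ ys enumᴮ F (σ a))) ⟩
  sumℚ (map (λ a → sumℚ (map (λ b → δ _≟ᴮ_ (σ a) b * F b) ys)) xs)
    ≡⟨ sumℚ-swap xs ys (λ a b → δ _≟ᴮ_ (σ a) b * F b) ⟩
  sumℚ (map (λ b → sumℚ (map (λ a → δ _≟ᴮ_ (σ a) b * F b) xs)) ys)
    ≡⟨ sumℚ-map-cong ys (λ b → trans
         (sumℚ-map-cong xs (λ a → cong (_* F b) (δ-transpose a b)))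
         (sumℚ-δ-* _≟ᴬ_ xs enumᴬ (λ _ → F b) (τ b))) ⟩
  sumℚ (map F ys) ∎
  where
  open ≡-Reasoning
  δ-transpose : ∀ a b → δ _≟ᴮ_ (σ a) b ≡ δ _≟ᴬ_ (τ b) a
  δ-transpose a b = δ-cong _≟ᴮ_ _≟ᴬ_
    (λ σa≡b → trans (cong τ (sym σa≡b)) (τσ a)) (λ τb≡a → trans (cong σ (sym τb≡a)) (στ b))

_≟ᶜ_ : ∀ {N} → DecidableEquality (Cube N)
_≟ᶜ_ = Vecₚ.≡-dec Bool._≟_

allPoints-enumerates : ∀ N → Enumerates _≟ᶜ_ (allPoints N)
allPoints-enumerates ℕ.zero    []      = refl
allPoints-enumerates (ℕ.suc N) (a ∷ x) = begin
  sumℚ (map (δ _≟ᶜ_ (a ∷ x)) (map (true ∷_) (allPoints N) List.++ map (false ∷_) (allPoints N)))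
    ≡⟨ cong sumℚ (Listₚ.map-++ (δ _≟ᶜ_ (a ∷ x)) (map (true ∷_) (allPoints N)) _) ⟩
  sumℚ (map (δ _≟ᶜ_ (a ∷ x)) (map (true ∷_) (allPoints N)) List.++ map (δ _≟ᶜ_ (a ∷ x)) (map (false ∷_) (allPoints N)))
    ≡⟨ sumℚ-++ (map (δ _≟ᶜ_ (a ∷ x)) (map (true ∷_) (allPoints N))) _ ⟩
  half true + half false
    ≡⟨ cong₂ _+_ (half≡ true) (half≡ false) ⟩
  δ Bool._≟_ a true + δ Bool._≟_ a false
    ≡⟨ δ-true+δ-false a ⟩
  1ℚ ∎
  where
  open ≡-Reasoning
  half : Bool → ℚ
  half b = sumℚ (map (δ _≟ᶜ_ (a ∷ x)) (map (b ∷_) (allPoints N)))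
  δ-∷ : ∀ c b y → δ _≟ᶜ_ (c ∷ x) (b ∷ y) ≡ δ Bool._≟_ c b * δ _≟ᶜ_ x y
  δ-∷ true  true  y = trans (δ-cong _≟ᶜ_ _≟ᶜ_ {true ∷ x} {true ∷ y} Vecₚ.∷-injectiveʳ (cong (true ∷_)))
                            (sym (*-identityˡ _))
  δ-∷ false false y = trans (δ-cong _≟ᶜ_ _≟ᶜ_ {false ∷ x} {false ∷ y} Vecₚ.∷-injectiveʳ (cong (false ∷_)))
                            (sym (*-identityˡ _))
  δ-∷ true  false y = trans (δ-≢ _≟ᶜ_ {true ∷ x} {false ∷ y} λ ()) (sym (*-zeroˡ (δ _≟ᶜ_ x y)))
  δ-∷ false true  y = trans (δ-≢ _≟ᶜ_ {false ∷ x} {true ∷ y} λ ()) (sym (*-zeroˡ (δ _≟ᶜ_ x y)))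
  half≡ : ∀ b → half b ≡ δ Bool._≟_ a b
  half≡ b = begin
    half b
      ≡⟨ sumℚ-map-∘ (δ _≟ᶜ_ (a ∷ x)) (b ∷_) (allPoints N) ⟩
    sumℚ (map (λ y → δ _≟ᶜ_ (a ∷ x) (b ∷ y)) (allPoints N))
      ≡⟨ sumℚ-map-cong (allPoints N) (δ-∷ a b) ⟩
    sumℚ (map (λ y → δ Bool._≟_ a b * δ _≟ᶜ_ x y) (allPoints N))
      ≡⟨ sumℚ-map-*ˡ (δ Bool._≟_ a b) (δ _≟ᶜ_ x) (allPoints N) ⟩
    δ Bool._≟_ a b * sumℚ (map (δ _≟ᶜ_ x) (allPoints N))
      ≡⟨ cong (δ Bool._≟_ a b *_) (allPoints-enumerates N x) ⟩
    δ Bool._≟_ a b * 1ℚ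
      ≡⟨ *-identityʳ _ ⟩
    δ Bool._≟_ a b ∎
  δ-true+δ-false : ∀ c → δ Bool._≟_ c true + δ Bool._≟_ c false ≡ 1ℚ
  δ-true+δ-false true  = refl
  δ-true+δ-false false = refl

allFin-enumerates : ∀ n → Enumerates Fin._≟_ (allFin n)
allFin-enumerates (ℕ.suc n) zero = begin
  sumℚ (map (δ Fin._≟_ zero) (allFin (ℕ.suc n)))
    ≡⟨ sumℚ-allFin-suc n (δ Fin._≟_ zero) ⟩
  1ℚ + sumℚ (map (δ Fin._≟_ zero ∘ suc) (allFin n))
    ≡⟨ cong (1ℚ +_) (trans (sumℚ-map-cong (allFin n) (λ j → δ-≢ Fin._≟_ {zero} {suc j} λ ()))
                           (sumℚ-map-0 (allFin n))) ⟩
  1ℚ + 0ℚ ∎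
  where open ≡-Reasoning
allFin-enumerates (ℕ.suc n) (suc a) = begin
  sumℚ (map (δ Fin._≟_ (suc a)) (allFin (ℕ.suc n)))
    ≡⟨ sumℚ-allFin-suc n (δ Fin._≟_ (suc a)) ⟩
  0ℚ + sumℚ (map (δ Fin._≟_ (suc a) ∘ suc) (allFin n))
    ≡⟨ +-identityˡ _ ⟩
  sumℚ (map (δ Fin._≟_ (suc a) ∘ suc) (allFin n))
    ≡⟨ sumℚ-map-cong (allFin n) (λ j → δ-cong Fin._≟_ Fin._≟_ {suc a} {suc j} Finₚ.suc-injective (cong suc)) ⟩
  sumℚ (map (δ Fin._≟_ a) (allFin n))
    ≡⟨ allFin-enumerates n a ⟩
  1ℚ ∎
  where open ≡-Reasoning

-- Relabelling variables

lookup-ext : ∀ {A : Set} {n} {xs ys : Vec A n} → (∀ i → lookup xs i ≡ lookup ys i) → xs ≡ ys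
lookup-ext {xs = xs} {ys} xs≗ys =
  trans (sym (Vecₚ.tabulate∘lookup xs)) (trans (Vecₚ.tabulate-cong xs≗ys) (Vecₚ.tabulate∘lookup ys))

module _ {M N : ℕ} (π : Permutation M N) where

  unpermuteInput : Cube M → Cube N
  unpermuteInput y = tabulate (λ i → lookup y (π ⟨$⟩ˡ i))

  unpermute∘permute : ∀ x → unpermuteInput (permuteInput π x) ≡ x
  unpermute∘permute x = lookup-ext λ i → begin
    lookup (unpermuteInput (permuteInput π x)) i  ≡⟨ Vecₚ.lookup∘tabulate _ i ⟩
    lookup (permuteInput π x) (π ⟨$⟩ˡ i)           ≡⟨ Vecₚ.lookup∘tabulate _ (π ⟨$⟩ˡ i) ⟩
    lookup x (π ⟨$⟩ʳ (π ⟨$⟩ˡ i))                   ≡⟨ cong (lookup x) (inverseʳ π) ⟩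
    lookup x i                                     ∎
    where open ≡-Reasoning

  permute∘unpermute : ∀ y → permuteInput π (unpermuteInput y) ≡ y
  permute∘unpermute y = lookup-ext λ j → begin
    lookup (permuteInput π (unpermuteInput y)) j  ≡⟨ Vecₚ.lookup∘tabulate _ j ⟩
    lookup (unpermuteInput y) (π ⟨$⟩ʳ j)           ≡⟨ Vecₚ.lookup∘tabulate _ (π ⟨$⟩ʳ j) ⟩
    lookup y (π ⟨$⟩ˡ (π ⟨$⟩ʳ j))                   ≡⟨ cong (lookup y) (inverseˡ π) ⟩
    lookup y j                                     ∎
    where open ≡-Reasoning

  E-permuteInput : ∀ (G : Cube M → ℚ) → E {N} (G ∘ permuteInput π) ≡ E {M} G
  E-permuteInput G = cong₂ _*_
    (sumℚ-reindex _≟ᶜ_ _≟ᶜ_ (allPoints N) (allPoints M) (allPoints-enumerates N) (allPoints-enumerates M)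
       (permuteInput π) unpermuteInput unpermute∘permute permute∘unpermute G)
    (cong invPow2 (sym (↔⇒≡ π)))

  permuteInput-flipAt : ∀ k x → permuteInput π (flipAt k x) ≡ flipAt (π ⟨$⟩ˡ k) (permuteInput π x)
  permuteInput-flipAt k x = lookup-ext pointwise
    where
    open ≡-Reasoning
    pointwise : ∀ j → lookup (permuteInput π (flipAt k x)) j ≡ lookup (flipAt (π ⟨$⟩ˡ k) (permuteInput π x)) j
    pointwise j with j Fin.≟ π ⟨$⟩ˡ k
    ... | yes refl = begin
      lookup (permuteInput π (flipAt k x)) j       ≡⟨ Vecₚ.lookup∘tabulate _ j ⟩
      lookup (updateAt x k not) (π ⟨$⟩ʳ j)         ≡⟨ cong (lookup (updateAt x k not)) (inverseʳ π) ⟩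
      lookup (updateAt x k not) k                  ≡⟨ Vecₚ.lookup∘updateAt k x ⟩
      not (lookup x k)                             ≡⟨ cong (not ∘ lookup x) (sym (inverseʳ π)) ⟩
      not (lookup x (π ⟨$⟩ʳ j))                    ≡⟨ cong not (sym (Vecₚ.lookup∘tabulate _ j)) ⟩
      not (lookup (permuteInput π x) j)            ≡⟨ sym (Vecₚ.lookup∘updateAt j (permuteInput π x)) ⟩
      lookup (flipAt j (permuteInput π x)) j       ∎
    ... | no j≢π⁻¹k = begin
      lookup (permuteInput π (flipAt k x)) j       ≡⟨ Vecₚ.lookup∘tabulate _ j ⟩
      lookup (updateAt x k not) (π ⟨$⟩ʳ j)         ≡⟨ Vecₚ.lookup∘updateAt′ (π ⟨$⟩ʳ j) k πj≢k x ⟩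
      lookup x (π ⟨$⟩ʳ j)                          ≡⟨ sym (Vecₚ.lookup∘tabulate _ j) ⟩
      lookup (permuteInput π x) j                  ≡⟨ sym (Vecₚ.lookup∘updateAt′ j _ j≢π⁻¹k (permuteInput π x)) ⟩
      lookup (flipAt (π ⟨$⟩ˡ k) (permuteInput π x)) j ∎
      where
      πj≢k : π ⟨$⟩ʳ j ≢ k
      πj≢k πj≡k = j≢π⁻¹k (trans (sym (inverseˡ π)) (cong (π ⟨$⟩ˡ_) πj≡k))

  module _ {F : BoolFun M} {h : BoolFun N} (h≗F∘π : ∀ x → h x ≡ F (permuteInput π x)) where

    Inf-permuteInput : ∀ k → Inf k h ≡ Inf (π ⟨$⟩ˡ k) F
    Inf-permuteInput k = trans
      (E-cong λ x → cong₂ differ (h≗F∘π x) (trans (h≗F∘π (flipAt k x)) (cong F (permuteInput-flipAt k x))))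
      (E-permuteInput (λ y → differ (F y) (F (flipAt (π ⟨$⟩ˡ k) y))))

    Balanced-permuteInput : Balanced F → Balanced h
    Balanced-permuteInput bal =
      trans (E-cong (λ x → cong val (h≗F∘π x))) (trans (E-permuteInput (val ∘ F)) bal)

  W1-permuteInput : ∀ {F₁ F₂ : BoolFun M} {h₁ h₂ : BoolFun N} →
                    (∀ x → h₁ x ≡ F₁ (permuteInput π x)) → (∀ x → h₂ x ≡ F₂ (permuteInput π x)) →
                    W1 h₁ h₂ ≡ W1 F₁ F₂
  W1-permuteInput {F₁} {F₂} h₁≗ h₂≗ = trans
    (sumℚ-map-cong (allFin N) λ k → cong₂ _*_ (Inf-permuteInput {F = F₁} h₁≗ k) (Inf-permuteInput {F = F₂} h₂≗ k))
    (sumℚ-reindex Fin._≟_ Fin._≟_ (allFin N) (allFin M) (allFin-enumerates N) (allFin-enumerates M)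
       (π ⟨$⟩ˡ_) (π ⟨$⟩ʳ_) (λ _ → inverseʳ π) (λ _ → inverseˡ π) (λ j → Inf j F₁ * Inf j F₂))

-- Composition with balanced functions

inner : ∀ {n} (sizes : Vec ℕ n) → ((i : Fin n) → BoolFun (lookup sizes i)) → Cube (Vec.sum sizes) → Cube n
inner sizes gs x = tabulate (λ i → gs i (blocks sizes x i))

splitAt-++ : ∀ {m n} (y : Cube m) (z : Cube n) → Vec.splitAt m (y ++ z) ≡ (y , z , refl)
splitAt-++ []      z = refl
splitAt-++ (a ∷ y) z rewrite splitAt-++ y z = refl

inner-++ : ∀ {n s} {ss : Vec ℕ n} (gs : (i : Fin (ℕ.suc n)) → BoolFun (lookup (s ∷ ss) i)) y z →
           inner (s ∷ ss) gs (y ++ z) ≡ gs zero y ∷ inner ss (gs ∘ suc) z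
inner-++ gs y z rewrite splitAt-++ y z = refl

flipAt-↑ˡ : ∀ {m n} (j : Fin m) (y : Cube m) (z : Cube n) → flipAt (j ↑ˡ n) (y ++ z) ≡ flipAt j y ++ z
flipAt-↑ˡ zero    (a ∷ y) z = refl
flipAt-↑ˡ (suc j) (a ∷ y) z = cong (a ∷_) (flipAt-↑ˡ j y z)

flipAt-↑ʳ : ∀ {m n} (k : Fin n) (y : Cube m) (z : Cube n) → flipAt (m ↑ʳ k) (y ++ z) ≡ y ++ flipAt k z
flipAt-↑ʳ k []      z = refl
flipAt-↑ʳ k (a ∷ y) z = cong (a ∷_) (flipAt-↑ʳ k y z)

E-inner : ∀ {n} (sizes : Vec ℕ n) (gs : (i : Fin n) → BoolFun (lookup sizes i)) → (∀ i → Balanced (gs i)) →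
          ∀ (Φ : Cube n → ℚ) → E (Φ ∘ inner sizes gs) ≡ E Φ
E-inner []       gs bal Φ = trans (E-[] (Φ ∘ inner [] gs)) (sym (E-[] Φ))
E-inner {ℕ.suc n} (s ∷ ss) gs bal Φ = begin
  E (Φ ∘ inner (s ∷ ss) gs)
    ≡⟨ E-++ s (Vec.sum ss) _ ⟩
  E {s} (λ y → E (λ z → Φ (inner (s ∷ ss) gs (y ++ z))))
    ≡⟨ E-cong (λ y → E-cong (λ z → cong Φ (inner-++ gs y z))) ⟩
  E {s} (λ y → E (λ z → Φ (gs zero y ∷ inner ss (gs ∘ suc) z)))
    ≡⟨ E-cong (λ y → E-inner ss (gs ∘ suc) (bal ∘ suc) (λ w → Φ (gs zero y ∷ w))) ⟩
  E {s} (λ y → E {n} (λ w → Φ (gs zero y ∷ w)))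
    ≡⟨ E-∘-balanced (gs zero) (bal zero) (λ b → E {n} (λ w → Φ (b ∷ w))) ⟩
  ½ * (E {n} (λ w → Φ (true ∷ w)) + E {n} (λ w → Φ (false ∷ w)))
    ≡⟨ sym (E-∷ Φ) ⟩
  E Φ ∎
  where open ≡-Reasoning

module _ {n} (sizes : Vec ℕ n) (gs : (i : Fin n) → BoolFun (lookup sizes i)) (bal : ∀ i → Balanced (gs i)) where

  Cov-compose : ∀ (f₁ f₂ : BoolFun n) → Cov (compose f₁ sizes gs) (compose f₂ sizes gs) ≡ Cov f₁ f₂
  Cov-compose f₁ f₂ = cong₂ _-_
    (E-inner sizes gs bal (λ y → val (f₁ y) * val (f₂ y)))
    (cong₂ _*_ (E-inner sizes gs bal (val ∘ f₁)) (E-inner sizes gs bal (val ∘ f₂)))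

  Balanced-compose : ∀ (f : BoolFun n) → Balanced f → Balanced (compose f sizes gs)
  Balanced-compose f balf = trans (E-inner sizes gs bal (val ∘ f)) balf

E-differ-∷ : ∀ {n} (f : BoolFun (ℕ.suc n)) a b →
             E (λ w → differ (f (a ∷ w)) (f (b ∷ w))) ≡ differ a b * Inf zero f
E-differ-∷ {n} f true  true  = trans (E-cong (λ w → differ-refl (f (true ∷ w))))
                                     (trans (E-const n 0ℚ) (sym (*-zeroˡ (Inf zero f))))
E-differ-∷ {n} f false false = trans (E-cong (λ w → differ-refl (f (false ∷ w))))
                                     (trans (E-const n 0ℚ) (sym (*-zeroˡ (Inf zero f))))
E-differ-∷ {n} f true  false = trans (sym (Inf-zero f)) (sym (*-identityˡ (Inf zero f)))
E-differ-∷ {n} f false true  = trans (E-cong (λ w → differ-sym (f (false ∷ w)) (f (true ∷ w))))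
                                     (trans (sym (Inf-zero f)) (sym (*-identityˡ (Inf zero f))))

sumℚ-avg*avg : ∀ {A : Set} (xs : List A) (a b c d : A → ℚ) →
  sumℚ (map (λ k → ½ * (a k + b k) * (½ * (c k + d k))) xs) ≡
  ½ * ½ * (sumℚ (map (λ k → a k * c k) xs) + sumℚ (map (λ k → a k * d k) xs)
         + sumℚ (map (λ k → b k * c k) xs) + sumℚ (map (λ k → b k * d k) xs))
sumℚ-avg*avg []       a b c d = refl
sumℚ-avg*avg (x ∷ xs) a b c d rewrite sumℚ-avg*avg xs a b c d =
  solve 8 (λ a b c d s₁ s₂ s₃ s₄ →
      con ½ :* (a :+ b) :* (con ½ :* (c :+ d)) :+ con ½ :* con ½ :* (s₁ :+ s₂ :+ s₃ :+ s₄)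
   := con ½ :* con ½ :* ((a :* c :+ s₁) :+ (a :* d :+ s₂) :+ (b :* c :+ s₃) :+ (b :* d :+ s₄)))
    refl (a x) (b x) (c x) (d x) _ _ _ _

module _ {n s} {ss : Vec ℕ n} (gs : (i : Fin (ℕ.suc n)) → BoolFun (lookup (s ∷ ss) i))
         (bal : ∀ i → Balanced (gs i)) where

  private
    r = Vec.sum ss
    tail = inner ss (gs ∘ suc)

  Inf-compose-↑ˡ : ∀ (f : BoolFun (ℕ.suc n)) (j : Fin s) →
                   Inf (j ↑ˡ r) (compose f (s ∷ ss) gs) ≡ Inf zero f * Inf j (gs zero)
  Inf-compose-↑ˡ f j = begin
    Inf (j ↑ˡ r) (compose f (s ∷ ss) gs)
      ≡⟨ E-++ s r _ ⟩
    E {s} (λ y → E {r} (λ z → differ (f (inner (s ∷ ss) gs (y ++ z)))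
                                     (f (inner (s ∷ ss) gs (flipAt (j ↑ˡ r) (y ++ z))))))
      ≡⟨ E-cong (λ y → E-cong (λ z → cong₂ differ (cong f (inner-++ gs y z))
           (trans (cong (f ∘ inner (s ∷ ss) gs) (flipAt-↑ˡ j y z)) (cong f (inner-++ gs (flipAt j y) z))))) ⟩
    E {s} (λ y → E {r} (λ z → differ (f (gs zero y ∷ tail z)) (f (gs zero (flipAt j y) ∷ tail z))))
      ≡⟨ E-cong (λ y → E-inner ss (gs ∘ suc) (bal ∘ suc)
           (λ w → differ (f (gs zero y ∷ w)) (f (gs zero (flipAt j y) ∷ w)))) ⟩
    E {s} (λ y → E {n} (λ w → differ (f (gs zero y ∷ w)) (f (gs zero (flipAt j y) ∷ w))))
      ≡⟨ E-cong (λ y → trans (E-differ-∷ f (gs zero y) (gs zero (flipAt j y))) (*-comm _ (Inf zero f))) ⟩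
    E {s} (λ y → Inf zero f * differ (gs zero y) (gs zero (flipAt j y)))
      ≡⟨ E-*ˡ (Inf zero f) (λ y → differ (gs zero y) (gs zero (flipAt j y))) ⟩
    Inf zero f * Inf j (gs zero) ∎
    where open ≡-Reasoning

  Inf-compose-↑ʳ : ∀ (f : BoolFun (ℕ.suc n)) (k : Fin r) →
                   Inf (s ↑ʳ k) (compose f (s ∷ ss) gs) ≡
                   ½ * (Inf k (compose (restrict true f) ss (gs ∘ suc)) + Inf k (compose (restrict false f) ss (gs ∘ suc)))
  Inf-compose-↑ʳ f k = begin
    Inf (s ↑ʳ k) (compose f (s ∷ ss) gs)
      ≡⟨ E-++ s r _ ⟩
    E {s} (λ y → E {r} (λ z → differ (f (inner (s ∷ ss) gs (y ++ z)))
                                     (f (inner (s ∷ ss) gs (flipAt (s ↑ʳ k) (y ++ z))))))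
      ≡⟨ E-cong (λ y → E-cong (λ z → cong₂ differ (cong f (inner-++ gs y z))
           (trans (cong (f ∘ inner (s ∷ ss) gs) (flipAt-↑ʳ k y z)) (cong f (inner-++ gs y (flipAt k z)))))) ⟩
    E {s} (λ y → E {r} (λ z → differ (f (gs zero y ∷ tail z)) (f (gs zero y ∷ tail (flipAt k z)))))
      ≡⟨ E-∘-balanced (gs zero) (bal zero) (λ b → E {r} (λ z → differ (f (b ∷ tail z)) (f (b ∷ tail (flipAt k z))))) ⟩
    ½ * (Inf k (compose (restrict true f) ss (gs ∘ suc)) + Inf k (compose (restrict false f) ss (gs ∘ suc))) ∎
    where open ≡-Reasoning

W1-compose : ∀ {n} (sizes : Vec ℕ n) (gs : (i : Fin n) → BoolFun (lookup sizes i)) → (∀ i → Balanced (gs i)) →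
             ∀ (f₁ f₂ : BoolFun n) →
             W1 (compose f₁ sizes gs) (compose f₂ sizes gs) ≡
             sumℚ (map (λ i → Inf i f₁ * W1 (gs i) (gs i) * Inf i f₂) (allFin n))
W1-compose []               gs bal f₁ f₂ = refl
W1-compose {ℕ.suc n} (s ∷ ss) gs bal f₁ f₂ = begin
  W1 (compose f₁ (s ∷ ss) gs) (compose f₂ (s ∷ ss) gs)
    ≡⟨ sumℚ-allFin-+ s r _ ⟩
  sumℚ (map (λ j → Inf (j ↑ˡ r) F₁ * Inf (j ↑ˡ r) F₂) (allFin s)) +
  sumℚ (map (λ k → Inf (s ↑ʳ k) F₁ * Inf (s ↑ʳ k) F₂) (allFin r))
    ≡⟨ cong₂ _+_ head tail ⟩
  weight zero + sumℚ (map (weight ∘ suc) (allFin n))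
    ≡⟨ sym (sumℚ-allFin-suc n weight) ⟩
  sumℚ (map weight (allFin (ℕ.suc n))) ∎
  where
  open ≡-Reasoning
  r = Vec.sum ss
  F₁ = compose f₁ (s ∷ ss) gs
  F₂ = compose f₂ (s ∷ ss) gs
  weight : Fin (ℕ.suc n) → ℚ
  weight i = Inf i f₁ * W1 (gs i) (gs i) * Inf i f₂

  head : sumℚ (map (λ j → Inf (j ↑ˡ r) F₁ * Inf (j ↑ˡ r) F₂) (allFin s)) ≡ weight zero
  head = begin
    sumℚ (map (λ j → Inf (j ↑ˡ r) F₁ * Inf (j ↑ˡ r) F₂) (allFin s))
      ≡⟨ sumℚ-map-cong (allFin s) (λ j → trans
           (cong₂ _*_ (Inf-compose-↑ˡ gs bal f₁ j) (Inf-compose-↑ˡ gs bal f₂ j))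
           (solve 3 (λ x y z → x :* z :* (y :* z) := x :* y :* (z :* z)) refl
              (Inf zero f₁) (Inf zero f₂) (Inf j (gs zero)))) ⟩
    sumℚ (map (λ j → Inf zero f₁ * Inf zero f₂ * (Inf j (gs zero) * Inf j (gs zero))) (allFin s))
      ≡⟨ sumℚ-map-*ˡ (Inf zero f₁ * Inf zero f₂) (λ j → Inf j (gs zero) * Inf j (gs zero)) (allFin s) ⟩
    Inf zero f₁ * Inf zero f₂ * W1 (gs zero) (gs zero)
      ≡⟨ solve 3 (λ x y w → x :* y :* w := x :* w :* y) refl (Inf zero f₁) (Inf zero f₂) (W1 (gs zero) (gs zero)) ⟩
    weight zero ∎

  cong₄ : ∀ {p p′ q q′ t t′ u u′} → p ≡ p′ → q ≡ q′ → t ≡ t′ → u ≡ u′ →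
          p + q + t + u ≡ p′ + q′ + t′ + u′
  cong₄ refl refl refl refl = refl

  Ĩ₁ Ĩ₂ : Bool → Fin r → ℚ
  Ĩ₁ b k = Inf k (compose (restrict b f₁) ss (gs ∘ suc))
  Ĩ₂ b k = Inf k (compose (restrict b f₂) ss (gs ∘ suc))
  I₁W I₂ : Bool → Fin n → ℚ
  I₁W b i = Inf i (restrict b f₁) * W1 (gs (suc i)) (gs (suc i))
  I₂  b i = Inf i (restrict b f₂)

  ΣĨ₁Ĩ₂ ΣI₁WI₂ : Bool → Bool → ℚ
  ΣĨ₁Ĩ₂  b b′ = sumℚ (map (λ k → Ĩ₁ b k * Ĩ₂ b′ k) (allFin r))
  ΣI₁WI₂ b b′ = sumℚ (map (λ i → I₁W b i * I₂ b′ i) (allFin n))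

  W1-tail : ∀ b b′ → ΣĨ₁Ĩ₂ b b′ ≡ ΣI₁WI₂ b b′
  W1-tail b b′ = W1-compose ss (gs ∘ suc) (bal ∘ suc) (restrict b f₁) (restrict b′ f₂)

  tail : sumℚ (map (λ k → Inf (s ↑ʳ k) F₁ * Inf (s ↑ʳ k) F₂) (allFin r)) ≡ sumℚ (map (weight ∘ suc) (allFin n))
  tail = begin
    sumℚ (map (λ k → Inf (s ↑ʳ k) F₁ * Inf (s ↑ʳ k) F₂) (allFin r))
      ≡⟨ sumℚ-map-cong (allFin r) (λ k → cong₂ _*_ (Inf-compose-↑ʳ gs bal f₁ k) (Inf-compose-↑ʳ gs bal f₂ k)) ⟩
    sumℚ (map (λ k → ½ * (Ĩ₁ true k + Ĩ₁ false k) * (½ * (Ĩ₂ true k + Ĩ₂ false k))) (allFin r))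
      ≡⟨ sumℚ-avg*avg (allFin r) (Ĩ₁ true) (Ĩ₁ false) (Ĩ₂ true) (Ĩ₂ false) ⟩
    ½ * ½ * (ΣĨ₁Ĩ₂ true true + ΣĨ₁Ĩ₂ true false + ΣĨ₁Ĩ₂ false true + ΣĨ₁Ĩ₂ false false)
      ≡⟨ cong (½ * ½ *_) (cong₄ (W1-tail true true) (W1-tail true false) (W1-tail false true) (W1-tail false false)) ⟩
    ½ * ½ * (ΣI₁WI₂ true true + ΣI₁WI₂ true false + ΣI₁WI₂ false true + ΣI₁WI₂ false false)
      ≡⟨ sym (sumℚ-avg*avg (allFin n) (I₁W true) (I₁W false) (I₂ true) (I₂ false)) ⟩
    sumℚ (map (λ i → ½ * (I₁W true i + I₁W false i) * (½ * (I₂ true i + I₂ false i))) (allFin n))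
      ≡⟨ sumℚ-map-cong (allFin n) (λ i → cong₂ _*_
           (trans (solve 3 (λ a b w → con ½ :* (a :* w :+ b :* w) := con ½ :* (a :+ b) :* w) refl
                     (Inf i (restrict true f₁)) (Inf i (restrict false f₁)) (W1 (gs (suc i)) (gs (suc i))))
                  (cong (_* W1 (gs (suc i)) (gs (suc i))) (sym (Inf-suc i f₁))))
           (sym (Inf-suc i f₂))) ⟩
    sumℚ (map (weight ∘ suc) (allFin n)) ∎

-- Level-one weight of increasing functions

sqNorm : ∀ {N} → Vec ℚ N → ℚ
sqNorm []       = 0ℚ
sqNorm (a ∷ as) = a * a + sqNorm as

infDot : ∀ {N} → Vec ℚ N → BoolFun N → ℚ
infDot {N} a h = sumℚ (map (λ j → lookup a j * Inf j h) (allFin N))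

affine : ∀ {N} → Vec ℚ N → ℚ → Cube N → ℚ
affine a θ x = linForm a x - θ

sqNorm≡sumℚ : ∀ {N} (a : Vec ℚ N) → sqNorm a ≡ sumℚ (map (λ j → lookup a j * lookup a j) (allFin N))
sqNorm≡sumℚ []       = refl
sqNorm≡sumℚ {ℕ.suc N} (a ∷ as) =
  trans (cong (a * a +_) (sqNorm≡sumℚ as)) (sym (sumℚ-allFin-suc N (λ j → lookup (a ∷ as) j * lookup (a ∷ as) j)))

0≤sqNorm : ∀ {N} (a : Vec ℚ N) → 0ℚ ≤ sqNorm a
0≤sqNorm []       = ≤-refl
0≤sqNorm (a ∷ as) = +-mono-≤ (0≤p*p a) (0≤sqNorm as)

sqNorm≡0⇒linForm≡0 : ∀ {N} (a : Vec ℚ N) → sqNorm a ≡ 0ℚ → ∀ x → linForm a x ≡ 0ℚ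
sqNorm≡0⇒linForm≡0 []       _    []      = refl
sqNorm≡0⇒linForm≡0 (a ∷ as) ‖a‖≡0 (b ∷ y) = begin
  a * val b + linForm as y ≡⟨ cong₂ (λ a′ l → a′ * val b + l) a≡0 (sqNorm≡0⇒linForm≡0 as ‖as‖≡0 y) ⟩
  0ℚ * val b + 0ℚ          ≡⟨ solve 1 (λ v → con 0ℚ :* v :+ con 0ℚ := con 0ℚ) refl (val b) ⟩
  0ℚ                       ∎
  where
  open ≡-Reasoning
  ‖as‖≡0 : sqNorm as ≡ 0ℚ
  ‖as‖≡0 = p+q≡0⇒p≡0 (0≤sqNorm as) (0≤p*p a) (trans (+-comm (sqNorm as) (a * a)) ‖a‖≡0)
  a≡0 : a ≡ 0ℚ
  a≡0 = p*p≡0⇒p≡0 a (p+q≡0⇒p≡0 (0≤p*p a) (0≤sqNorm as) ‖a‖≡0)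

-- For increasing h the influence Iⱼ(h) is the Fourier coefficient E[h xⱼ].
E-val*linForm : ∀ {N} (a : Vec ℚ N) (h : BoolFun N) → Increasing h →
                E (λ x → val (h x) * linForm a x) ≡ infDot a h
E-val*linForm []              h inc = trans (E-[] (λ x → val (h x) * linForm [] x)) (*-zeroʳ (val (h [])))
E-val*linForm {ℕ.suc N} (a₀ ∷ as) h inc = begin
  E (λ x → val (h x) * linForm (a₀ ∷ as) x)
    ≡⟨ E-∷ (λ x → val (h x) * linForm (a₀ ∷ as) x) ⟩
  ½ * (E (λ y → vᵀ y * (a₀ * 1ℚ + L y)) + E (λ y → vᶠ y * (a₀ * - 1ℚ + L y)))
    ≡⟨ cong (½ *_) (cong₂ _+_
         (trans (E-cong (λ y → solve 3 (λ v a l → v :* (a :* con 1ℚ :+ l) := a :* v :+ v :* l) refl (vᵀ y) a₀ (L y)))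
                (E-*+ a₀ vᵀ (λ y → vᵀ y * L y)))
         (trans (E-cong (λ y → solve 3 (λ v a l → v :* (a :* con (- 1ℚ) :+ l) := (:- a) :* v :+ v :* l) refl (vᶠ y) a₀ (L y)))
                (E-*+ (- a₀) vᶠ (λ y → vᶠ y * L y)))) ⟩
  ½ * ((a₀ * E vᵀ + E (λ y → vᵀ y * L y)) + (- a₀ * E vᶠ + E (λ y → vᶠ y * L y)))
    ≡⟨ cong₂ (λ p q → ½ * ((a₀ * E vᵀ + p) + (- a₀ * E vᶠ + q)))
         (E-val*linForm as (restrict true h) (Increasing-restrict true h inc))
         (E-val*linForm as (restrict false h) (Increasing-restrict false h inc)) ⟩
  ½ * ((a₀ * E vᵀ + infDot as (restrict true h)) + (- a₀ * E vᶠ + infDot as (restrict false h)))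
    ≡⟨ solve 5 (λ a t f p q → con ½ :* ((a :* t :+ p) :+ (:- a :* f :+ q)) := a :* (con ½ :* (t :- f)) :+ con ½ :* (p :+ q))
         refl a₀ (E vᵀ) (E vᶠ) (infDot as (restrict true h)) (infDot as (restrict false h)) ⟩
  a₀ * (½ * (E vᵀ - E vᶠ)) + ½ * (infDot as (restrict true h) + infDot as (restrict false h))
    ≡⟨ cong₂ (λ p q → a₀ * p + q) (sym (Inf-zero-increasing h inc)) average-tail ⟩
  a₀ * Inf zero h + sumℚ (map (λ j → lookup as j * Inf (suc j) h) (allFin N))
    ≡⟨ sym (sumℚ-allFin-suc N (λ j → lookup (a₀ ∷ as) j * Inf j h)) ⟩
  infDot (a₀ ∷ as) h ∎
  where
  open ≡-Reasoning
  vᵀ vᶠ L : Cube N → ℚ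
  vᵀ y = val (h (true ∷ y))
  vᶠ y = val (h (false ∷ y))
  L    = linForm as
  term : Bool → Fin N → ℚ
  term b j = lookup as j * Inf j (restrict b h)
  average-tail : ½ * (infDot as (restrict true h) + infDot as (restrict false h)) ≡
                 sumℚ (map (λ j → lookup as j * Inf (suc j) h) (allFin N))
  average-tail = begin
    ½ * (infDot as (restrict true h) + infDot as (restrict false h))
      ≡⟨ cong (½ *_) (sym (sumℚ-map-+ (term true) (term false) (allFin N))) ⟩
    ½ * sumℚ (map (λ j → term true j + term false j) (allFin N))
      ≡⟨ sym (sumℚ-map-*ˡ ½ (λ j → term true j + term false j) (allFin N)) ⟩
    sumℚ (map (λ j → ½ * (term true j + term false j)) (allFin N))
      ≡⟨ sumℚ-map-cong (allFin N) (λ j → trans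
           (solve 3 (λ a p q → con ½ :* (a :* p :+ a :* q) := a :* (con ½ :* (p :+ q))) refl
              (lookup as j) (Inf j (restrict true h)) (Inf j (restrict false h)))
           (cong (lookup as j *_) (sym (Inf-suc j h)))) ⟩
    sumℚ (map (λ j → lookup as j * Inf (suc j) h) (allFin N)) ∎

E-affine² : ∀ {N} (a : Vec ℚ N) θ → E (λ x → affine a θ x * affine a θ x) ≡ sqNorm a + θ * θ
E-affine² []              θ = trans (E-[] (λ x → affine [] θ x * affine [] θ x))
  (solve 1 (λ t → (con 0ℚ :- t) :* (con 0ℚ :- t) := con 0ℚ :+ t :* t) refl θ)
E-affine² {ℕ.suc N} (a₀ ∷ as) θ = begin
  E (λ x → affine (a₀ ∷ as) θ x * affine (a₀ ∷ as) θ x)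
    ≡⟨ E-∷ (λ x → affine (a₀ ∷ as) θ x * affine (a₀ ∷ as) θ x) ⟩
  ½ * (E Sᵀ + E Sᶠ)
    ≡⟨ sym (trans (E-*ˡ ½ (λ y → Sᵀ y + Sᶠ y)) (cong (½ *_) (E-+ Sᵀ Sᶠ))) ⟩
  E (λ y → ½ * (Sᵀ y + Sᶠ y))
    ≡⟨ E-cong (λ y → solve 3 (λ a l t →
          con ½ :* ((a :* con 1ℚ :+ l :- t) :* (a :* con 1ℚ :+ l :- t) :+ (a :* con (- 1ℚ) :+ l :- t) :* (a :* con (- 1ℚ) :+ l :- t))
       := a :* a :* con 1ℚ :+ (l :- t) :* (l :- t)) refl a₀ (linForm as y) θ) ⟩
  E (λ y → a₀ * a₀ * 1ℚ + affine as θ y * affine as θ y)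
    ≡⟨ E-*+ (a₀ * a₀) (λ _ → 1ℚ) (λ y → affine as θ y * affine as θ y) ⟩
  a₀ * a₀ * E {N} (λ _ → 1ℚ) + E (λ y → affine as θ y * affine as θ y)
    ≡⟨ cong₂ (λ p q → a₀ * a₀ * p + q) (E-const N 1ℚ) (E-affine² as θ) ⟩
  a₀ * a₀ * 1ℚ + (sqNorm as + θ * θ)
    ≡⟨ solve 3 (λ a s t → a :* a :* con 1ℚ :+ (s :+ t :* t) := (a :* a :+ s) :+ t :* t) refl a₀ (sqNorm as) θ ⟩
  sqNorm (a₀ ∷ as) + θ * θ ∎
  where
  open ≡-Reasoning
  Sᵀ Sᶠ : Cube N → ℚ
  Sᵀ y = (a₀ * 1ℚ + linForm as y - θ) * (a₀ * 1ℚ + linForm as y - θ)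
  Sᶠ y = (a₀ * - 1ℚ + linForm as y - θ) * (a₀ * - 1ℚ + linForm as y - θ)

-- Bessel: 0 ≤ E[(h − Σ Iⱼ(h) xⱼ)²] = 1 − W₁(h,h).
W1≤1 : ∀ {N} (h : BoolFun N) → Increasing h → W1 h h ≤ 1ℚ
W1≤1 {N} h inc = ≤-fromDiff (1ℚ - W) (subst (0ℚ ≤_) E-residual² (E-nonNeg (λ x → 0≤p*p (val (h x) - L x)))) refl
  where
  open ≡-Reasoning
  W = W1 h h
  I : Vec ℚ N
  I = tabulate (λ j → Inf j h)
  L : Cube N → ℚ
  L = linForm I
  infDot≡W : infDot I h ≡ W
  infDot≡W = sumℚ-map-cong (allFin N) (λ j → cong (_* Inf j h) (Vecₚ.lookup∘tabulate _ j))
  E-L² : E (λ x → affine I 0ℚ x * affine I 0ℚ x) ≡ W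
  E-L² = begin
    E (λ x → affine I 0ℚ x * affine I 0ℚ x) ≡⟨ E-affine² I 0ℚ ⟩
    sqNorm I + 0ℚ * 0ℚ                      ≡⟨ +-identityʳ (sqNorm I) ⟩
    sqNorm I                                ≡⟨ sqNorm≡sumℚ I ⟩
    sumℚ (map (λ j → lookup I j * lookup I j) (allFin N))
      ≡⟨ sumℚ-map-cong (allFin N) (λ j → cong₂ _*_ (Vecₚ.lookup∘tabulate _ j) (Vecₚ.lookup∘tabulate _ j)) ⟩
    W                                       ∎
  L² rest : Cube N → ℚ
  L² x = affine I 0ℚ x * affine I 0ℚ x
  rest x = - (1ℚ + 1ℚ) * (val (h x) * L x) + L² x
  E-residual² : E (λ x → (val (h x) - L x) * (val (h x) - L x)) ≡ 1ℚ - W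
  E-residual² = begin
    E (λ x → (val (h x) - L x) * (val (h x) - L x))
      ≡⟨ E-cong (λ x → trans
           (solve 2 (λ v l → (v :- l) :* (v :- l) := v :* v :+ (con (- (1ℚ + 1ℚ)) :* (v :* l) :+ (l :- con 0ℚ) :* (l :- con 0ℚ))) refl
              (val (h x)) (L x))
           (cong (_+ rest x) (val*val (h x)))) ⟩
    E (λ x → 1ℚ + rest x)
      ≡⟨ trans (E-+ (λ _ → 1ℚ) rest) (cong₂ _+_ (E-const N 1ℚ) (E-*+ (- (1ℚ + 1ℚ)) (λ x → val (h x) * L x) L²)) ⟩
    1ℚ + (- (1ℚ + 1ℚ) * E (λ x → val (h x) * L x) + E (λ x → affine I 0ℚ x * affine I 0ℚ x))
      ≡⟨ cong₂ (λ p q → 1ℚ + (- (1ℚ + 1ℚ) * p + q)) (trans (E-val*linForm I h inc) infDot≡W) E-L² ⟩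
    1ℚ + (- (1ℚ + 1ℚ) * W + W)
      ≡⟨ solve 1 (λ w → con 1ℚ :+ (con (- (1ℚ + 1ℚ)) :* w :+ w) := con 1ℚ :- w) refl W ⟩
    1ℚ - W ∎

-- Linear threshold functions have level-one weight at least 1/6

3ℚ 4ℚ 6ℚ : ℚ
3ℚ = ℤ.+ 3 / 1
4ℚ = ℤ.+ 4 / 1
6ℚ = ℤ.+ 6 / 1

E-affine⁴ : ∀ {N} (a : Vec ℚ N) θ →
            E (λ x → (affine a θ x * affine a θ x) * (affine a θ x * affine a θ x)) ≤
            3ℚ * ((sqNorm a + θ * θ) * (sqNorm a + θ * θ))
E-affine⁴ [] θ = begin
  E (λ x → (affine [] θ x * affine [] θ x) * (affine [] θ x * affine [] θ x))
    ≡⟨ E-[] (λ x → (affine [] θ x * affine [] θ x) * (affine [] θ x * affine [] θ x)) ⟩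
  ((0ℚ - θ) * (0ℚ - θ)) * ((0ℚ - θ) * (0ℚ - θ))
    ≤⟨ ≤-fromDiff ((1ℚ + 1ℚ) * ((θ * θ) * (θ * θ))) (0≤p*q (nonNegative⁻¹ (1ℚ + 1ℚ)) (0≤p*p (θ * θ)))
         (solve 1 (λ t → con 3ℚ :* ((con 0ℚ :+ t :* t) :* (con 0ℚ :+ t :* t)) :- ((con 0ℚ :- t) :* (con 0ℚ :- t)) :* ((con 0ℚ :- t) :* (con 0ℚ :- t))
                      := (con 1ℚ :+ con 1ℚ) :* ((t :* t) :* (t :* t))) refl θ) ⟩
  3ℚ * ((0ℚ + θ * θ) * (0ℚ + θ * θ)) ∎
  where open ≤-Reasoning
E-affine⁴ {ℕ.suc N} (a₀ ∷ as) θ = begin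
  E (λ x → sq (sq (affine (a₀ ∷ as) θ x)))
    ≡⟨ E-∷ (λ x → sq (sq (affine (a₀ ∷ as) θ x))) ⟩
  ½ * (E Qᵀ + E Qᶠ)
    ≡⟨ sym (trans (E-*ˡ ½ (λ y → Qᵀ y + Qᶠ y)) (cong (½ *_) (E-+ Qᵀ Qᶠ))) ⟩
  E (λ y → ½ * (Qᵀ y + Qᶠ y))
    ≡⟨ E-cong (λ y → solve 3 (λ a l t →
         con ½ :* (((a :* con 1ℚ :+ l :- t) :* (a :* con 1ℚ :+ l :- t)) :* ((a :* con 1ℚ :+ l :- t) :* (a :* con 1ℚ :+ l :- t))
                :+ ((a :* con (- 1ℚ) :+ l :- t) :* (a :* con (- 1ℚ) :+ l :- t)) :* ((a :* con (- 1ℚ) :+ l :- t) :* (a :* con (- 1ℚ) :+ l :- t)))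
      := a :* a :* (a :* a) :+ con 6ℚ :* (a :* a) :* ((l :- t) :* (l :- t)) :+ ((l :- t) :* (l :- t)) :* ((l :- t) :* (l :- t)))
         refl a₀ (linForm as y) θ) ⟩
  E (λ y → a₀ * a₀ * (a₀ * a₀) + 6ℚ * (a₀ * a₀) * sq (affine as θ y) + sq (sq (affine as θ y)))
    ≡⟨ E-+ (λ y → a₀ * a₀ * (a₀ * a₀) + 6ℚ * (a₀ * a₀) * sq (affine as θ y)) (λ y → sq (sq (affine as θ y))) ⟩
  E (λ y → a₀ * a₀ * (a₀ * a₀) + 6ℚ * (a₀ * a₀) * sq (affine as θ y)) + E (λ y → sq (sq (affine as θ y)))
    ≡⟨ cong (_+ E (λ y → sq (sq (affine as θ y)))) (trans
         (E-+ (λ _ → a₀ * a₀ * (a₀ * a₀)) (λ y → 6ℚ * (a₀ * a₀) * sq (affine as θ y)))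
         (cong₂ _+_ (E-const N _) (trans (E-*ˡ (6ℚ * (a₀ * a₀)) (λ y → sq (affine as θ y)))
                                         (cong (6ℚ * (a₀ * a₀) *_) (E-affine² as θ))))) ⟩
  a₀ * a₀ * (a₀ * a₀) + 6ℚ * (a₀ * a₀) * B + E (λ y → sq (sq (affine as θ y)))
    ≤⟨ +-monoʳ-≤ (a₀ * a₀ * (a₀ * a₀) + 6ℚ * (a₀ * a₀) * B) (E-affine⁴ as θ) ⟩
  a₀ * a₀ * (a₀ * a₀) + 6ℚ * (a₀ * a₀) * B + 3ℚ * (B * B)
    ≤⟨ ≤-fromDiff ((1ℚ + 1ℚ) * ((a₀ * a₀) * (a₀ * a₀))) (0≤p*q (nonNegative⁻¹ (1ℚ + 1ℚ)) (0≤p*p (a₀ * a₀)))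
         (solve 3 (λ a s t → con 3ℚ :* ((a :* a :+ s :+ t :* t) :* (a :* a :+ s :+ t :* t))
                           :- (a :* a :* (a :* a) :+ con 6ℚ :* (a :* a) :* (s :+ t :* t) :+ con 3ℚ :* ((s :+ t :* t) :* (s :+ t :* t)))
                          := (con 1ℚ :+ con 1ℚ) :* ((a :* a) :* (a :* a))) refl a₀ (sqNorm as) θ) ⟩
  3ℚ * ((sqNorm (a₀ ∷ as) + θ * θ) * (sqNorm (a₀ ∷ as) + θ * θ)) ∎
  where
  open ≤-Reasoning
  sq : ℚ → ℚ
  sq p = p * p
  B = sqNorm as + θ * θ
  Qᵀ Qᶠ : Cube N → ℚ
  Qᵀ y = sq (sq (a₀ * 1ℚ + linForm as y - θ))
  Qᶠ y = sq (sq (a₀ * - 1ℚ + linForm as y - θ))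

tangent-bound : ∀ {t y} → 0ℚ < t → 0ℚ ≤ y → 4ℚ * t * t * (y * y) ≤ 4ℚ * t * t * t * y + (y * y) * (y * y)
tangent-bound {t} {y} 0<t 0≤y = ≤-fromDiff
  (y * (y * ((y - t) * (y - t)) + (1ℚ + 1ℚ) * t * ((y - ρ * t) * (y - ρ * t)) + κ * (t * t * t)))
  (0≤p*q 0≤y (+-mono-≤ (+-mono-≤ (0≤p*q 0≤y (0≤p*p (y - t)))
                            (0≤p*q (0≤p*q (nonNegative⁻¹ (1ℚ + 1ℚ)) 0≤t) (0≤p*p (y - ρ * t))))
                     (0≤p*q (nonNegative⁻¹ κ) (0≤p*q (0≤p*q 0≤t 0≤t) 0≤t))))
  (solve 2 (λ t y → con 4ℚ :* t :* t :* t :* y :+ (y :* y) :* (y :* y) :- con 4ℚ :* t :* t :* (y :* y)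
                 := y :* (y :* ((y :- t) :* (y :- t)) :+ (con 1ℚ :+ con 1ℚ) :* t :* ((y :- con ρ :* t) :* (y :- con ρ :* t))
                          :+ con κ :* (t :* t :* t))) refl t y)
  where
  0≤t = <⇒≤ 0<t
  ρ κ : ℚ
  ρ = ℤ.+ 5 / 4
  κ = ℤ.+ 7 / 8

-- Take t = B / 2u in the hypothesis; when B > 0, t = B + 1 rules out u = 0.
≤6*square : ∀ {B u} → 0ℚ ≤ u →
            (∀ t → 0ℚ < t → 4ℚ * t * t * B ≤ 4ℚ * t * t * t * u + 3ℚ * (B * B)) → B ≤ 6ℚ * u * u
≤6*square {B} {u} 0≤u bound with <-cmp 0ℚ B
... | tri≈ _ 0≡B _ = subst (_≤ 6ℚ * u * u) 0≡B (0≤p*q (0≤p*q (nonNegative⁻¹ 6ℚ) 0≤u) 0≤u)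
... | tri> _ _ B<0 = ≤-trans (<⇒≤ B<0) (0≤p*q (0≤p*q (nonNegative⁻¹ 6ℚ) 0≤u) 0≤u)
... | tri< 0<B _ _ = *-cancelˡ-≤-pos (½ * (B * B)) {{positive 0<½B²}}
      (≤-fromDiff (½ * (B * B) * (6ℚ * u * u - B))
        (subst (0ℚ ≤_) at-t*u²≡ (0≤p*q (≤⇒0≤diff (bound t 0<t)) (0≤p*p u)))
        (solve 2 (λ B u → con ½ :* (B :* B) :* (con 6ℚ :* u :* u) :- con ½ :* (B :* B) :* B
                       := con ½ :* (B :* B) :* (con 6ℚ :* u :* u :- B)) refl B u))
  where
  0<½B² : 0ℚ < ½ * (B * B)
  0<½B² = 0<p*q (positive⁻¹ ½) (0<p*q 0<B 0<B)
  0<u : 0ℚ < u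
  0<u with <-cmp 0ℚ u
  ... | tri< 0<u _ _ = 0<u
  ... | tri> _ _ u<0 = ⊥-elim (<⇒≱ u<0 0≤u)
  ... | tri≈ _ 0≡u _ = ⊥-elim (<⇒≱ gap<0 (≤⇒0≤diff
        (subst (λ u → 4ℚ * t * t * B ≤ 4ℚ * t * t * t * u + 3ℚ * (B * B)) (sym 0≡u) (bound t 0<t))))
    where
    t = B + 1ℚ
    0<t : 0ℚ < t
    0<t = +-mono-<-≤ 0<B (nonNegative⁻¹ 1ℚ)
    ρ κ : ℚ
    ρ = ℤ.+ 5 / 8
    κ = ℤ.+ 39 / 16
    gap<0 : 4ℚ * t * t * t * 0ℚ + 3ℚ * (B * B) - 4ℚ * t * t * B < 0ℚ
    gap<0 = subst (_< 0ℚ)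
      (solve 1 (λ b → :- (b :* (con κ :+ con 4ℚ :* ((b :+ con ρ) :* (b :+ con ρ))))
                   := con 4ℚ :* (b :+ con 1ℚ) :* (b :+ con 1ℚ) :* (b :+ con 1ℚ) :* con 0ℚ :+ con 3ℚ :* (b :* b)
                      :- con 4ℚ :* (b :+ con 1ℚ) :* (b :+ con 1ℚ) :* b) refl B)
      (neg-antimono-< (0<p*q 0<B (+-mono-<-≤ (positive⁻¹ κ) (0≤p*q (nonNegative⁻¹ 4ℚ) (0≤p*p (B + ρ))))))
  instance
    u≢0 : NonZero u
    u≢0 = pos⇒nonZero u {{positive 0<u}}
  t = B * (1/ u) * ½
  0<t : 0ℚ < t
  0<t = 0<p*q (0<p*q 0<B (positive⁻¹ _ {{1/pos⇒pos u {{positive 0<u}}}})) (positive⁻¹ ½)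
  at-t*u²≡ : (4ℚ * t * t * t * u + 3ℚ * (B * B) - 4ℚ * t * t * B) * (u * u) ≡ ½ * (B * B) * (6ℚ * u * u - B)
  at-t*u²≡ = begin
    (4ℚ * t * t * t * u + 3ℚ * (B * B) - 4ℚ * t * t * B) * (u * u)
      ≡⟨ solve 3 (λ b i u →
           (con 4ℚ :* (b :* i :* con ½) :* (b :* i :* con ½) :* (b :* i :* con ½) :* u :+ con 3ℚ :* (b :* b)
              :- con 4ℚ :* (b :* i :* con ½) :* (b :* i :* con ½) :* b) :* (u :* u)
        := con ½ :* (b :* b :* b) :* ((i :* u) :* (i :* u) :* (i :* u)) :+ con 3ℚ :* (b :* b) :* (u :* u)
              :- b :* b :* b :* ((i :* u) :* (i :* u))) refl B (1/ u) u ⟩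
    ½ * (B * B * B) * (1/ u * u * (1/ u * u) * (1/ u * u)) + 3ℚ * (B * B) * (u * u) - B * B * B * (1/ u * u * (1/ u * u))
      ≡⟨ cong (λ z → ½ * (B * B * B) * (z * z * z) + 3ℚ * (B * B) * (u * u) - B * B * B * (z * z)) (*-inverseˡ u) ⟩
    ½ * (B * B * B) * (1ℚ * 1ℚ * 1ℚ) + 3ℚ * (B * B) * (u * u) - B * B * B * (1ℚ * 1ℚ)
      ≡⟨ solve 2 (λ b u → con ½ :* (b :* b :* b) :* (con 1ℚ :* con 1ℚ :* con 1ℚ) :+ con 3ℚ :* (b :* b) :* (u :* u)
                          :- b :* b :* b :* (con 1ℚ :* con 1ℚ)
                       := con ½ :* (b :* b) :* (con 6ℚ :* u :* u :- b)) refl B u ⟩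
    ½ * (B * B) * (6ℚ * u * u - B) ∎
    where open ≡-Reasoning

secondMoment≤6*firstMoment² : ∀ {N} (F : Cube N → ℚ) → (∀ x → 0ℚ ≤ F x) →
  E (λ x → (F x * F x) * (F x * F x)) ≤ 3ℚ * (E (λ x → F x * F x) * E (λ x → F x * F x)) →
  E (λ x → F x * F x) ≤ 6ℚ * E F * E F
secondMoment≤6*firstMoment² F 0≤F fourth≤ = ≤6*square (E-nonNeg 0≤F) λ t 0<t → begin
  4ℚ * t * t * B                                                ≡⟨ sym (E-*ˡ (4ℚ * t * t) (λ x → F x * F x)) ⟩
  E (λ x → 4ℚ * t * t * (F x * F x))                            ≤⟨ E-mono (λ x → tangent-bound 0<t (0≤F x)) ⟩
  E (λ x → 4ℚ * t * t * t * F x + (F x * F x) * (F x * F x))    ≡⟨ E-*+ (4ℚ * t * t * t) F _ ⟩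
  4ℚ * t * t * t * E F + E (λ x → (F x * F x) * (F x * F x))    ≤⟨ +-monoʳ-≤ (4ℚ * t * t * t * E F) fourth≤ ⟩
  4ℚ * t * t * t * E F + 3ℚ * (B * B)                           ∎
  where
  open ≤-Reasoning
  B = E (λ x → F x * F x)

module _ {A : Set} (xs : List A) (p q : A → ℚ) where

  private
    ∑ : (A → ℚ) → ℚ
    ∑ F = sumℚ (map F xs)

  sumℚ-square-expand : ∀ α β →
    ∑ (λ x → (α * q x - β * p x) * (α * q x - β * p x)) ≡
    α * α * ∑ (λ x → q x * q x) - (1ℚ + 1ℚ) * α * β * ∑ (λ x → p x * q x) + β * β * ∑ (λ x → p x * p x)
  sumℚ-square-expand α β = go xs
    where
    go : ∀ ys → sumℚ (map (λ x → (α * q x - β * p x) * (α * q x - β * p x)) ys) ≡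
                α * α * sumℚ (map (λ x → q x * q x) ys) - (1ℚ + 1ℚ) * α * β * sumℚ (map (λ x → p x * q x) ys)
                + β * β * sumℚ (map (λ x → p x * p x) ys)
    go []       = solve 2 (λ α β → con 0ℚ
                                := α :* α :* con 0ℚ :- (con 1ℚ :+ con 1ℚ) :* α :* β :* con 0ℚ :+ β :* β :* con 0ℚ) refl α β
    go (y ∷ ys) rewrite go ys =
      solve 7 (λ α β p q Q S P →
          (α :* q :- β :* p) :* (α :* q :- β :* p) :+ (α :* α :* Q :- (con 1ℚ :+ con 1ℚ) :* α :* β :* S :+ β :* β :* P)
       := α :* α :* (q :* q :+ Q) :- (con 1ℚ :+ con 1ℚ) :* α :* β :* (p :* q :+ S) :+ β :* β :* (p :* p :+ P))
        refl α β (p y) (q y) _ _ _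

  cauchySchwarz : 0ℚ < ∑ (λ x → p x * p x) →
                  ∑ (λ x → p x * q x) * ∑ (λ x → p x * q x) ≤ ∑ (λ x → p x * p x) * ∑ (λ x → q x * q x)
  cauchySchwarz 0<P = ≤-fromDiff (P * Q - S * S) (*-cancelˡ-≤-pos P {{positive 0<P}}
      (subst₂ _≤_ (sym (*-zeroʳ P)) expand (sumℚ-map-nonNeg xs (λ x → 0≤p*p (P * q x - S * p x)))))
    refl
    where
    P = ∑ (λ x → p x * p x)
    Q = ∑ (λ x → q x * q x)
    S = ∑ (λ x → p x * q x)
    expand : ∑ (λ x → (P * q x - S * p x) * (P * q x - S * p x)) ≡ P * (P * Q - S * S)
    expand = trans (sumℚ-square-expand P S)
      (solve 3 (λ P Q S → P :* P :* Q :- (con 1ℚ :+ con 1ℚ) :* P :* S :* S :+ S :* S :* P := P :* (P :* Q :- S :* S)) refl P Q S)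

0≤val[sign]* : ∀ q → 0ℚ ≤ val (sign q) * q
0≤val[sign]* q with 0ℚ ≤? q
... | yes 0≤q = subst (0ℚ ≤_) (sym (*-identityˡ q)) 0≤q
... | no  0≰q = subst (0ℚ ≤_) (trans (sym (-‿cong (*-identityˡ q))) (neg-distribˡ-* 1ℚ q))
                      (neg-antimono-≤ (<⇒≤ (≰⇒> 0≰q)))

module _ {N} {h : BoolFun N} (a : Vec ℚ N) (θ : ℚ) (h≡sign : ∀ x → h x ≡ sign (affine a θ x))
         (inc : Increasing h) (bal : Balanced h) where

  private
    A B u : ℚ
    A = sqNorm a
    B = A + θ * θ
    u = infDot a h
    F : Cube N → ℚ
    F x = val (h x) * affine a θ x

    0≤F : ∀ x → 0ℚ ≤ F x
    0≤F x = subst (λ b → 0ℚ ≤ val b * affine a θ x) (sym (h≡sign x)) (0≤val[sign]* (affine a θ x))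

    F²≡affine² : ∀ x → F x * F x ≡ affine a θ x * affine a θ x
    F²≡affine² x = begin
      F x * F x
        ≡⟨ solve 2 (λ v m → (v :* m) :* (v :* m) := (v :* v) :* (m :* m)) refl (val (h x)) (affine a θ x) ⟩
      (val (h x) * val (h x)) * (affine a θ x * affine a θ x)
        ≡⟨ cong (_* (affine a θ x * affine a θ x)) (val*val (h x)) ⟩
      1ℚ * (affine a θ x * affine a θ x)
        ≡⟨ *-identityˡ _ ⟩
      affine a θ x * affine a θ x ∎
      where open ≡-Reasoning

    E-F : E F ≡ u
    E-F = begin
      E F
        ≡⟨ E-cong (λ x → solve 3 (λ v l t → v :* (l :- t) := (:- t) :* v :+ v :* l) refl (val (h x)) (linForm a x) θ) ⟩
      E (λ x → - θ * val (h x) + val (h x) * linForm a x)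
        ≡⟨ E-*+ (- θ) (val ∘ h) (λ x → val (h x) * linForm a x) ⟩
      - θ * E (val ∘ h) + E (λ x → val (h x) * linForm a x)
        ≡⟨ cong₂ (λ e e′ → - θ * e + e′) bal (E-val*linForm a h inc) ⟩
      - θ * 0ℚ + u
        ≡⟨ solve 2 (λ t u → :- t :* con 0ℚ :+ u := u) refl θ u ⟩
      u ∎
      where open ≡-Reasoning

    E-F² : E (λ x → F x * F x) ≡ B
    E-F² = trans (E-cong F²≡affine²) (E-affine² a θ)

    B≤6u² : B ≤ 6ℚ * u * u
    B≤6u² = subst₂ (λ b e → b ≤ 6ℚ * e * e) E-F² E-F (secondMoment≤6*firstMoment² F 0≤F
      (subst₂ (λ e b → e ≤ 3ℚ * (b * b)) (sym (E-cong (λ x → cong₂ _*_ (F²≡affine² x) (F²≡affine² x)))) (sym E-F²)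
         (E-affine⁴ a θ)))

    -- a = 0 would make h the constant sign(−θ), which is not balanced.
    0<A : 0ℚ < A
    0<A with <-cmp 0ℚ A
    ... | tri< 0<A _ _ = 0<A
    ... | tri> _ _ A<0 = ⊥-elim (<⇒≱ A<0 (0≤sqNorm a))
    ... | tri≈ _ 0≡A _ = ⊥-elim (val≢0 (sign (0ℚ - θ)) (begin
      val (sign (0ℚ - θ))             ≡⟨ sym (E-const N (val (sign (0ℚ - θ)))) ⟩
      E {N} (λ _ → val (sign (0ℚ - θ)))
        ≡⟨ E-cong (λ x → cong (λ l → val (sign (l - θ))) (sym (sqNorm≡0⇒linForm≡0 a (sym 0≡A) x))) ⟩
      E (λ x → val (sign (affine a θ x))) ≡⟨ E-cong (λ x → cong val (sym (h≡sign x))) ⟩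
      E (val ∘ h)                     ≡⟨ bal ⟩
      0ℚ                              ∎))
      where
      open ≡-Reasoning
      val≢0 : ∀ b → val b ≢ 0ℚ
      val≢0 true  ()
      val≢0 false ()

    u²≤A*W : u * u ≤ A * W1 h h
    u²≤A*W = subst (λ p → u * u ≤ p * W1 h h) (sym (sqNorm≡sumℚ a))
      (cauchySchwarz (allFin N) (lookup a) (λ j → Inf j h) (subst (0ℚ <_) (sqNorm≡sumℚ a) 0<A))

  1≤6*W1-ltf : 1ℚ ≤ 6ℚ * W1 h h
  1≤6*W1-ltf = *-cancelˡ-≤-pos A {{positive 0<A}} (begin
    A * 1ℚ              ≡⟨ *-identityʳ A ⟩
    A                   ≤⟨ subst (_≤ B) (+-identityʳ A) (+-monoʳ-≤ A (0≤p*p θ)) ⟩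
    B                   ≤⟨ B≤6u² ⟩
    6ℚ * u * u          ≡⟨ *-assoc 6ℚ u u ⟩
    6ℚ * (u * u)        ≤⟨ *-monoˡ-≤-0≤ (nonNegative⁻¹ 6ℚ) u²≤A*W ⟩
    6ℚ * (A * W1 h h)   ≡⟨ solve 3 (λ s a w → s :* (a :* w) := a :* (s :* w)) refl 6ℚ A (W1 h h) ⟩
    A * (6ℚ * W1 h h)   ∎)
    where open ≤-Reasoning

-- Truncated exponential series

private
  1/[1+_] [1+_] : ℕ → ℚ
  1/[1+ j ] = ℤ.+ 1 / ℕ.suc j
  [1+ j ]   = ℤ.+ ℕ.suc j / 1

1/[1+j]*[1+j]≡1 : ∀ j → 1/[1+ j ] * [1+ j ] ≡ 1ℚ
1/[1+j]*[1+j]≡1 j = toℚᵘ-injective (ℚᵘₚ.≃-trans (toℚᵘ-homo-* 1/[1+ j ] [1+ j ])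
  (ℚᵘₚ.≃-trans (ℚᵘₚ.*-cong (toℚᵘ-fromℚᵘ (ℚᵘ.mkℚᵘ (ℤ.+ 1) j)) (toℚᵘ-fromℚᵘ (ℚᵘ.mkℚᵘ (ℤ.+ ℕ.suc j) 0)))
    (ℚᵘ.*≡* (cong ℤ.+_ (ℕₚ.*-assoc 1 (ℕ.suc j) 1)))))

1+[1+j]≡[2+j] : ∀ j → 1ℚ + [1+ j ] ≡ [1+ ℕ.suc j ]
1+[1+j]≡[2+j] j = toℚᵘ-injective (ℚᵘₚ.≃-trans (toℚᵘ-homo-+ 1ℚ [1+ j ])
  (ℚᵘₚ.≃-trans (ℚᵘₚ.+-cong (ℚᵘₚ.≃-refl {ℚᵘ.mkℚᵘ (ℤ.+ 1) 0}) (toℚᵘ-fromℚᵘ (ℚᵘ.mkℚᵘ (ℤ.+ ℕ.suc j) 0)))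
    (ℚᵘₚ.≃-trans
      (ℚᵘ.*≡* (cong ℤ.+_ (trans (ℕₚ.*-identityʳ _)
        (trans (cong ℕ.suc (ℕₚ.*-identityʳ (ℕ.suc j))) (sym (ℕₚ.*-identityʳ (2 ℕ.+ j)))))))
      (ℚᵘₚ.≃-sym (toℚᵘ-fromℚᵘ (ℚᵘ.mkℚᵘ (ℤ.+ ℕ.suc (ℕ.suc j)) 0))))))

0≤1/[1+j] : ∀ j → 0ℚ ≤ 1/[1+ j ]
0≤1/[1+j] j = nonNegative⁻¹ _ {{normalize-nonNeg 1 (ℕ.suc j)}}

0≤expTerm : ∀ j {x} → 0ℚ ≤ x → 0ℚ ≤ expTerm j x
0≤expTerm ℕ.zero    0≤x = nonNegative⁻¹ 1ℚ
0≤expTerm (ℕ.suc j) 0≤x = 0≤p*q (0≤p*q (0≤expTerm j 0≤x) 0≤x) (0≤1/[1+j] j)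

expTerm-mono : ∀ j {x y} → 0ℚ ≤ x → x ≤ y → expTerm j x ≤ expTerm j y
expTerm-mono ℕ.zero    0≤x x≤y = ≤-refl
expTerm-mono (ℕ.suc j) 0≤x x≤y = *-monoʳ-≤-0≤ (0≤1/[1+j] j)
  (≤-trans (*-monoʳ-≤-0≤ 0≤x (expTerm-mono j 0≤x x≤y)) (*-monoˡ-≤-0≤ (0≤expTerm j (≤-trans 0≤x x≤y)) x≤y))

0≤expPartial : ∀ n {x} → 0ℚ ≤ x → 0ℚ ≤ expPartial n x
0≤expPartial ℕ.zero    0≤x = nonNegative⁻¹ 1ℚ
0≤expPartial (ℕ.suc n) 0≤x = +-mono-≤ (0≤expPartial n 0≤x) (0≤expTerm (ℕ.suc n) 0≤x)

expPartial-mono : ∀ n {x y} → 0ℚ ≤ x → x ≤ y → expPartial n x ≤ expPartial n y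
expPartial-mono ℕ.zero    0≤x x≤y = ≤-refl
expPartial-mono (ℕ.suc n) 0≤x x≤y = +-mono-≤ (expPartial-mono n 0≤x x≤y) (expTerm-mono (ℕ.suc n) 0≤x x≤y)

expPartial-≤-suc : ∀ n {x} → 0ℚ ≤ x → expPartial n x ≤ expPartial (ℕ.suc n) x
expPartial-≤-suc n {x} 0≤x =
  subst (_≤ expPartial (ℕ.suc n) x) (+-identityʳ (expPartial n x)) (+-monoʳ-≤ (expPartial n x) (0≤expTerm (ℕ.suc n) 0≤x))

-- The first two terms of the binomial expansion of (x + b)ʲ⁺¹ / (j + 1)!.
expTerm-+ : ∀ j {x b} → 0ℚ ≤ x → 0ℚ ≤ b → expTerm (ℕ.suc j) x + b * expTerm j x ≤ expTerm (ℕ.suc j) (x + b)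
expTerm-+ ℕ.zero {x} {b} _ _ =
  ≤-reflexive (solve 2 (λ x b → con 1ℚ :* x :* con 1ℚ :+ b :* con 1ℚ := con 1ℚ :* (x :+ b) :* con 1ℚ) refl x b)
expTerm-+ (ℕ.suc j) {x} {b} 0≤x 0≤b = begin
  T (ℕ.suc (ℕ.suc j)) x + b * T (ℕ.suc j) x
    ≤⟨ ≤-fromDiff (b * b * T j x * c′) (0≤p*q (0≤p*q (0≤p*p b) (0≤expTerm j 0≤x)) (0≤1/[1+j] (ℕ.suc j))) gap ⟩
  (T (ℕ.suc j) x + b * T j x) * (x + b) * c′
    ≤⟨ *-monoʳ-≤-0≤ (0≤1/[1+j] (ℕ.suc j)) (*-monoʳ-≤-0≤ (+-mono-≤ 0≤x 0≤b) (expTerm-+ j 0≤x 0≤b)) ⟩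
  T (ℕ.suc j) (x + b) * (x + b) * c′ ∎
  where
  open ≤-Reasoning
  T = expTerm
  c = 1/[1+ j ]
  c′ = 1/[1+ ℕ.suc j ]
  gap : (T j x * x * c + b * T j x) * (x + b) * c′ - (T j x * x * c * x * c′ + b * (T j x * x * c)) ≡ b * b * T j x * c′
  gap = begin-equality
    (T j x * x * c + b * T j x) * (x + b) * c′ - (T j x * x * c * x * c′ + b * (T j x * x * c))
      ≡⟨ solve 6 (λ t x b c n c′ →
           (t :* x :* c :+ b :* t) :* (x :+ b) :* c′ :- (t :* x :* c :* x :* c′ :+ b :* (t :* x :* c))
        := b :* (t :* x :* c) :* (c′ :* (con 1ℚ :+ n) :- con 1ℚ) :+ b :* t :* x :* c′ :* (con 1ℚ :- c :* n) :+ b :* b :* t :* c′)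
           refl (T j x) x b c [1+ j ] c′ ⟩
    b * (T j x * x * c) * (c′ * (1ℚ + [1+ j ]) - 1ℚ) + b * T j x * x * c′ * (1ℚ - c * [1+ j ]) + b * b * T j x * c′
      ≡⟨ cong₂ (λ p q → b * (T j x * x * c) * (p - 1ℚ) + b * T j x * x * c′ * (1ℚ - q) + b * b * T j x * c′)
           (trans (cong (c′ *_) (1+[1+j]≡[2+j] j)) (1/[1+j]*[1+j]≡1 (ℕ.suc j))) (1/[1+j]*[1+j]≡1 j) ⟩
    b * (T j x * x * c) * (1ℚ - 1ℚ) + b * T j x * x * c′ * (1ℚ - 1ℚ) + b * b * T j x * c′
      ≡⟨ solve 3 (λ p q r → p :* (con 1ℚ :- con 1ℚ) :+ q :* (con 1ℚ :- con 1ℚ) :+ r := r) refl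
           (b * (T j x * x * c)) (b * T j x * x * c′) (b * b * T j x * c′) ⟩
    b * b * T j x * c′ ∎

expPartial-+ : ∀ n {x b} → 0ℚ ≤ x → 0ℚ ≤ b →
               expPartial (ℕ.suc n) x + b * expPartial n x ≤ expPartial (ℕ.suc n) (x + b)
expPartial-+ ℕ.zero {x} {b} 0≤x 0≤b =
  subst (_≤ 1ℚ + expTerm 1 (x + b))
    (solve 2 (λ t b → con 1ℚ :+ (t :+ b :* con 1ℚ) := (con 1ℚ :+ t) :+ b :* con 1ℚ) refl (expTerm 1 x) b)
    (+-monoʳ-≤ 1ℚ (expTerm-+ 0 0≤x 0≤b))
expPartial-+ (ℕ.suc n) {x} {b} 0≤x 0≤b =
  subst (_≤ expPartial (ℕ.suc (ℕ.suc n)) (x + b))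
    (solve 5 (λ s₁ s₀ t₂ t₁ b → (s₁ :+ b :* s₀) :+ (t₂ :+ b :* t₁) := (s₁ :+ t₂) :+ b :* (s₀ :+ t₁)) refl
       (expPartial (ℕ.suc n) x) (expPartial n x) (expTerm (ℕ.suc (ℕ.suc n)) x) (expTerm (ℕ.suc n) x) b)
    (+-mono-≤ (expPartial-+ n 0≤x 0≤b) (expTerm-+ (ℕ.suc n) 0≤x 0≤b))

-- The truncated form of (1 + b) eˣ ≤ eˣ⁺ᵇ.
1+b*expPartial≤ : ∀ n {x b} → 0ℚ ≤ x → 0ℚ ≤ b → (1ℚ + b) * expPartial n x ≤ expPartial (ℕ.suc n) (x + b)
1+b*expPartial≤ n {x} {b} 0≤x 0≤b = ≤-trans
  (subst (_≤ expPartial (ℕ.suc n) x + b * expPartial n x)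
     (solve 2 (λ s b → s :+ b :* s := (con 1ℚ :+ b) :* s) refl (expPartial n x) b)
     (+-monoˡ-≤ (b * expPartial n x) (expPartial-≤-suc n 0≤x)))
  (expPartial-+ n 0≤x 0≤b)

-- Transferring the φ-bound

module _ {K b c w w̃ : ℚ} (0<K : 0ℚ < K) (0<b : 0ℚ < b) (0≤w̃ : 0ℚ ≤ w̃) (w̃≤w : w̃ ≤ w) (w≤1 : w ≤ 1ℚ)
         (w≤[1+b]w̃ : w ≤ (1ℚ + b) * w̃) where

  private
    0≤b = <⇒≤ 0<b
    0≤1+b : 0ℚ ≤ 1ℚ + b
    0≤1+b = +-mono-≤ (nonNegative⁻¹ 1ℚ) 0≤b

  -- With r = 1 − Kw/c ≤ ln w ≤ 0 we get Kw/c ≥ 1, hence for K′ = K(1 + b)² the exponent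
  -- r′ = 1 − K′w̃/c ≤ r − b ≤ ln w − ln (1 + b) ≤ ln w̃.
  module _ (0<c : 0ℚ < c) (e^r≤w : ExpLe (1ℚ - (K * w ÷ c) {{>-nonZero 0<c}}) w) where

    private
      1/c = (1/ c) {{>-nonZero 0<c}}
      r r′ : ℚ
      r  = 1ℚ - K * w * 1/c
      r′ = 1ℚ - K * (1ℚ + b) * (1ℚ + b) * w̃ * 1/c

      0<1/c : 0ℚ < 1/c
      0<1/c = positive⁻¹ _ {{1/pos⇒pos c {{positive 0<c}}}}

      r≤0 : r ≤ 0ℚ
      r≤0 with ≤-total r 0ℚ
      ... | inj₁ r≤0 = r≤0
      ... | inj₂ 0≤r = ≤-fromDiff (1ℚ - expPartial 1 r) (≤⇒0≤diff (≤-trans (proj₁ e^r≤w 0≤r 1) w≤1))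
                         (solve 1 (λ r → con 0ℚ :- r := con 1ℚ :- (con 1ℚ :+ con 1ℚ :* r :* con 1ℚ)) refl r)

      r′≤r-b : r′ ≤ r - b
      r′≤r-b = ≤-fromDiff (K * 1/c * (1ℚ + b) * ((1ℚ + b) * w̃ - w) + b * (0ℚ - r))
        (+-mono-≤ (0≤p*q (0≤p*q (0≤p*q (<⇒≤ 0<K) (<⇒≤ 0<1/c)) 0≤1+b) (≤⇒0≤diff w≤[1+b]w̃)) (0≤p*q 0≤b (≤⇒0≤diff r≤0)))
        (solve 5 (λ K b w w̃ i → (con 1ℚ :- K :* w :* i :- b) :- (con 1ℚ :- K :* (con 1ℚ :+ b) :* (con 1ℚ :+ b) :* w̃ :* i)
                  := K :* i :* (con 1ℚ :+ b) :* ((con 1ℚ :+ b) :* w̃ :- w) :+ b :* (con 0ℚ :- (con 1ℚ :- K :* w :* i))) refl K b w w̃ 1/c)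

      r′<0 : r′ < 0ℚ
      r′<0 = <-fromDiff (b + ((r - b) - r′) + (0ℚ - r)) (+-mono-<-≤ (+-mono-<-≤ 0<b (≤⇒0≤diff r′≤r-b)) (≤⇒0≤diff r≤0))
        (solve 3 (λ b r r′ → con 0ℚ :- r′ := b :+ ((r :- b) :- r′) :+ (con 0ℚ :- r)) refl b r r′)

      0≤-r : 0ℚ ≤ - r
      0≤-r = neg-antimono-≤ r≤0

      -r+b≤-r′ : - r + b ≤ - r′
      -r+b≤-r′ = ≤-fromDiff ((r - b) - r′) (≤⇒0≤diff r′≤r-b)
        (solve 3 (λ b r r′ → (:- r′) :- (:- r :+ b) := (r :- b) :- r′) refl b r r′)

      w*e^-r≥1 : ∀ ε → 0ℚ < ε → ∃ λ n → 1ℚ - ε ≤ w * expPartial n (- r)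
      w*e^-r≥1 ε 0<ε with <-cmp r 0ℚ
      ... | tri< r<0 _ _ = proj₂ e^r≤w r<0 ε 0<ε
      ... | tri> _ _ r>0 = ⊥-elim (<⇒≱ r>0 r≤0)
      ... | tri≈ _ r≡0 _ = 0 , ≤-trans
              (≤-fromDiff ε (<⇒≤ 0<ε) (solve 1 (λ e → con 1ℚ :- (con 1ℚ :- e) := e) refl ε))
              (subst (1ℚ ≤_) (sym (*-identityʳ w)) (proj₁ e^r≤w (≤-reflexive (sym r≡0)) 0))

    e^r′≤w̃ : ExpLe (1ℚ - (K * (1ℚ + b) * (1ℚ + b) * w̃ ÷ c) {{>-nonZero 0<c}}) w̃
    e^r′≤w̃ = (λ 0≤r′ → ⊥-elim (<⇒≱ r′<0 0≤r′)) ,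
             λ _ ε 0<ε → let (n , bound) = w*e^-r≥1 ε 0<ε in ℕ.suc n , (begin
      1ℚ - ε                               ≤⟨ bound ⟩
      w * expPartial n (- r)               ≤⟨ *-monoʳ-≤-0≤ (0≤expPartial n 0≤-r) w≤[1+b]w̃ ⟩
      (1ℚ + b) * w̃ * expPartial n (- r)    ≡⟨ solve 3 (λ d w s → d :* w :* s := w :* (d :* s)) refl (1ℚ + b) w̃ (expPartial n (- r)) ⟩
      w̃ * ((1ℚ + b) * expPartial n (- r))  ≤⟨ *-monoˡ-≤-0≤ 0≤w̃ (1+b*expPartial≤ n 0≤-r 0≤b) ⟩
      w̃ * expPartial (ℕ.suc n) (- r + b)   ≤⟨ *-monoˡ-≤-0≤ 0≤w̃ (expPartial-mono (ℕ.suc n) (+-mono-≤ 0≤-r 0≤b) -r+b≤-r′) ⟩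
      w̃ * expPartial (ℕ.suc n) (- r′)      ∎)
      where open ≤-Reasoning

  PhiBound-transfer : PhiBound K c w → PhiBound (K * (1ℚ + b) * (1ℚ + b)) c w̃
  PhiBound-transfer (at-0 , below-e , above-e) = at-0′ , below-e′ , above-e′
    where
    at-0′ : w̃ ≤ 0ℚ → c ≤ 0ℚ
    at-0′ w̃≤0 = at-0 (≤-trans w≤[1+b]w̃ (subst ((1ℚ + b) * w̃ ≤_) (*-zeroʳ (1ℚ + b)) (*-monoˡ-≤-0≤ 0≤1+b w̃≤0)))
    below-e′ : 0ℚ < w̃ → LtE w̃ → c ≤ 0ℚ ⊎ Σ (0ℚ < c) (λ 0<c → ExpLe (1ℚ - (K * (1ℚ + b) * (1ℚ + b) * w̃ ÷ c) {{>-nonZero 0<c}}) w̃)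
    below-e′ 0<w̃ _ with below-e (<-≤-trans 0<w̃ w̃≤w) (1 , ≤-<-trans w≤1 (<-fromDiff 1ℚ (positive⁻¹ 1ℚ) refl))
    ... | inj₁ c≤0          = inj₁ c≤0
    ... | inj₂ (0<c , e^r≤w) = inj₂ (0<c , e^r′≤w̃ 0<c e^r≤w)
    above-e′ : GtE w̃ → Σ (c < 0ℚ) (λ c<0 → ExpLe (1ℚ - (K * (1ℚ + b) * (1ℚ + b) * w̃ ÷ c) {{<-nonZero c<0}}) w̃)
    above-e′ (ε , 0<ε , e+ε≤w̃) = ⊥-elim (<⇒≱ (<-fromDiff ε 0<ε (solve 1 (λ e → (con 1ℚ :+ e) :- con 1ℚ := e) refl ε))
                                               (≤-trans (e+ε≤w̃ 0) (≤-trans w̃≤w w≤1)))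

-- Weighted majority functions

6^_ : ℕ → ℚ
6^ ℕ.zero  = 1ℚ
6^ ℕ.suc j = 6ℚ * 6^ j

1≤6^ : ∀ j → 1ℚ ≤ 6^ j
1≤6^ ℕ.zero    = ≤-refl
1≤6^ (ℕ.suc j) = ≤-trans (1≤6^ j) (subst (_≤ 6ℚ * 6^ j) (*-identityˡ (6^ j))
  (*-monoʳ-≤-0≤ (≤-trans (nonNegative⁻¹ 1ℚ) (1≤6^ j)) (≤-fromDiff {1ℚ} {6ℚ} (ℤ.+ 5 / 1) (nonNegative⁻¹ _) refl)))

6^-mono : ∀ {j k} → j ℕ.≤ k → 6^ j ≤ 6^ k
6^-mono {ℕ.zero}  {k}       z≤n       = 1≤6^ k
6^-mono {ℕ.suc j} {ℕ.suc k} (s≤s j≤k) = *-monoˡ-≤-0≤ (nonNegative⁻¹ 6ℚ) (6^-mono j≤k)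

0≤W1 : ∀ {N} (h₁ h₂ : BoolFun N) → 0ℚ ≤ W1 h₁ h₂
0≤W1 {N} h₁ h₂ = sumℚ-map-nonNeg (allFin N) (λ j → 0≤p*q (0≤Inf j h₁) (0≤Inf j h₂))

W1-pair≤1 : ∀ {N} (f₁ f₂ : BoolFun N) → Increasing f₁ → Increasing f₂ → W1 f₁ f₂ ≤ 1ℚ
W1-pair≤1 {N} f₁ f₂ inc₁ inc₂ = begin
  W1 f₁ f₂
    ≤⟨ sumℚ-map-mono (allFin N) (λ j → ≤-fromDiff (½ * ((Inf j f₁ - Inf j f₂) * (Inf j f₁ - Inf j f₂)))
         (0≤p*q (nonNegative⁻¹ ½) (0≤p*p (Inf j f₁ - Inf j f₂)))
         (solve 2 (λ x y → con ½ :* (x :* x) :+ con ½ :* (y :* y) :- x :* y := con ½ :* ((x :- y) :* (x :- y))) refl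
            (Inf j f₁) (Inf j f₂))) ⟩
  sumℚ (map (λ j → ½ * (Inf j f₁ * Inf j f₁) + ½ * (Inf j f₂ * Inf j f₂)) (allFin N))
    ≡⟨ trans (sumℚ-map-+ (λ j → ½ * (Inf j f₁ * Inf j f₁)) (λ j → ½ * (Inf j f₂ * Inf j f₂)) (allFin N))
         (cong₂ _+_ (sumℚ-map-*ˡ ½ (λ j → Inf j f₁ * Inf j f₁) (allFin N)) (sumℚ-map-*ˡ ½ (λ j → Inf j f₂ * Inf j f₂) (allFin N))) ⟩
  ½ * W1 f₁ f₁ + ½ * W1 f₂ f₂
    ≤⟨ +-mono-≤ (*-monoˡ-≤-0≤ (nonNegative⁻¹ ½) (W1≤1 f₁ inc₁)) (*-monoˡ-≤-0≤ (nonNegative⁻¹ ½) (W1≤1 f₂ inc₂)) ⟩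
  ½ * 1ℚ + ½ * 1ℚ
    ≡⟨⟩
  1ℚ ∎
  where open ≤-Reasoning

module _ {A : Set} (xs : List A) (p Wt q : A → ℚ) (0≤p : ∀ i → 0ℚ ≤ p i) (0≤q : ∀ i → 0ℚ ≤ q i) where

  sumℚ-weighted≤ : (∀ i → Wt i ≤ 1ℚ) → sumℚ (map (λ i → p i * Wt i * q i) xs) ≤ sumℚ (map (λ i → p i * q i) xs)
  sumℚ-weighted≤ Wt≤1 = sumℚ-map-mono xs λ i →
    *-monoʳ-≤-0≤ (0≤q i) (subst (p i * Wt i ≤_) (*-identityʳ (p i)) (*-monoˡ-≤-0≤ (0≤p i) (Wt≤1 i)))

  sumℚ≤*weighted : ∀ D → (∀ i → 1ℚ ≤ D * Wt i) →
                   sumℚ (map (λ i → p i * q i) xs) ≤ D * sumℚ (map (λ i → p i * Wt i * q i) xs)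
  sumℚ≤*weighted D 1≤DWt = subst (sumℚ (map (λ i → p i * q i) xs) ≤_) (sumℚ-map-*ˡ D (λ i → p i * Wt i * q i) xs)
    (sumℚ-map-mono xs λ i → subst₂ _≤_ (*-identityʳ (p i * q i))
      (solve 4 (λ p q d w → p :* q :* (d :* w) := d :* (p :* w :* q)) refl (p i) (q i) D (Wt i))
      (*-monoˡ-≤-0≤ (0≤p*q (0≤p i) (0≤q i)) (1≤DWt i)))

WM⇒Balanced : ∀ {j N h} → WM j N h → Balanced h
WM⇒Balanced (layer1 (_ , _ , bal))                = bal
WM⇒Balanced (layerS {f = f} sizes gs π h (_ , _ , balf) wms h≗) =
  Balanced-permuteInput π {F = compose f sizes gs} h≗ (Balanced-compose sizes gs (λ i → WM⇒Balanced (wms i)) f balf)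

W1-layerS : ∀ {k m N} (f : BoolFun m) (sizes : Vec ℕ m) (gs : (i : Fin m) → BoolFun (lookup sizes i))
            (π : Permutation (Vec.sum sizes) N) {h : BoolFun N} → (∀ i → WM k (lookup sizes i) (gs i)) →
            (∀ x → h x ≡ compose f sizes gs (permuteInput π x)) →
            W1 h h ≡ sumℚ (map (λ i → Inf i f * W1 (gs i) (gs i) * Inf i f) (allFin m))
W1-layerS f sizes gs π wms h≗ =
  trans (W1-permuteInput π {F₁ = compose f sizes gs} {F₂ = compose f sizes gs} h≗ h≗)
        (W1-compose sizes gs (λ i → WM⇒Balanced (wms i)) f f)

WM⇒W1≤1 : ∀ {j N h} → WM j N h → W1 h h ≤ 1ℚ
WM⇒W1≤1 {h = h} (layer1 (_ , inc , _)) = W1≤1 h inc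
WM⇒W1≤1 (layerS {f = f} sizes gs π h (_ , incf , _) wms h≗) = begin
  W1 h h
    ≡⟨ W1-layerS f sizes gs π wms h≗ ⟩
  sumℚ (map (λ i → Inf i f * W1 (gs i) (gs i) * Inf i f) (allFin _))
    ≤⟨ sumℚ-weighted≤ (allFin _) (λ i → Inf i f) (λ i → W1 (gs i) (gs i)) (λ i → Inf i f)
         (λ i → 0≤Inf i f) (λ i → 0≤Inf i f) (λ i → WM⇒W1≤1 (wms i)) ⟩
  W1 f f
    ≤⟨ W1≤1 f incf ⟩
  1ℚ ∎
  where open ≤-Reasoning

WM⇒1≤6^*W1 : ∀ {j N h} → WM j N h → 1ℚ ≤ 6^ j * W1 h h
WM⇒1≤6^*W1 {h = h} (layer1 ((a , θ , h≡sign) , inc , bal)) =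
  subst (λ c → 1ℚ ≤ c * W1 h h) (sym (*-identityʳ 6ℚ)) (1≤6*W1-ltf a θ h≡sign inc bal)
WM⇒1≤6^*W1 {ℕ.suc k} (layerS {f = f} sizes gs π h ((a , θ , f≡sign) , incf , balf) wms h≗) = begin
  1ℚ
    ≤⟨ 1≤6*W1-ltf a θ f≡sign incf balf ⟩
  6ℚ * W1 f f
    ≤⟨ *-monoˡ-≤-0≤ (nonNegative⁻¹ 6ℚ)
         (sumℚ≤*weighted (allFin _) (λ i → Inf i f) (λ i → W1 (gs i) (gs i)) (λ i → Inf i f)
           (λ i → 0≤Inf i f) (λ i → 0≤Inf i f) (6^ k) (λ i → WM⇒1≤6^*W1 (wms i))) ⟩
  6ℚ * (6^ k * sumℚ (map (λ i → Inf i f * W1 (gs i) (gs i) * Inf i f) (allFin _)))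
    ≡⟨ sym (*-assoc 6ℚ (6^ k) _) ⟩
  6^ ℕ.suc k * sumℚ (map (λ i → Inf i f * W1 (gs i) (gs i) * Inf i f) (allFin _))
    ≡⟨ cong (6^ ℕ.suc k *_) (sym (W1-layerS f sizes gs π wms h≗)) ⟩
  6^ ℕ.suc k * W1 h h ∎
  where open ≤-Reasoning

module _ {k n} (sizes : Vec ℕ n) (gs : (i : Fin n) → BoolFun (lookup sizes i))
         (wm : ∀ i → WMAtMost k (lookup sizes i) (gs i)) where

  WMAtMost⇒Balanced : ∀ i → Balanced (gs i)
  WMAtMost⇒Balanced i = WM⇒Balanced (proj₂ (proj₂ (wm i)))

  module _ (f₁ f₂ : BoolFun n) where

    private
      Wᵢ : Fin n → ℚ
      Wᵢ i = W1 (gs i) (gs i)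

      W1-compose≡ : W1 (compose f₁ sizes gs) (compose f₂ sizes gs) ≡
                    sumℚ (map (λ i → Inf i f₁ * Wᵢ i * Inf i f₂) (allFin n))
      W1-compose≡ = W1-compose sizes gs WMAtMost⇒Balanced f₁ f₂

    W1-compose≤W1 : W1 (compose f₁ sizes gs) (compose f₂ sizes gs) ≤ W1 f₁ f₂
    W1-compose≤W1 = subst (_≤ W1 f₁ f₂) (sym W1-compose≡)
      (sumℚ-weighted≤ (allFin n) (λ i → Inf i f₁) Wᵢ (λ i → Inf i f₂) (λ i → 0≤Inf i f₁) (λ i → 0≤Inf i f₂)
         (λ i → WM⇒W1≤1 (proj₂ (proj₂ (wm i)))))

    W1≤6^*W1-compose : W1 f₁ f₂ ≤ 6^ k * W1 (compose f₁ sizes gs) (compose f₂ sizes gs)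
    W1≤6^*W1-compose = subst (λ w → W1 f₁ f₂ ≤ 6^ k * w) (sym W1-compose≡)
      (sumℚ≤*weighted (allFin n) (λ i → Inf i f₁) Wᵢ (λ i → Inf i f₂) (λ i → 0≤Inf i f₁) (λ i → 0≤Inf i f₂) (6^ k)
         λ i → let (j , j≤k , wmᵢ) = wm i in
               ≤-trans (WM⇒1≤6^*W1 wmᵢ) (*-monoʳ-≤-0≤ (0≤W1 (gs i) (gs i)) (6^-mono j≤k)))

    PhiBound-compose : ∀ {K} → 0ℚ < K → Increasing f₁ → Increasing f₂ → PhiBound K (Cov f₁ f₂) (W1 f₁ f₂) →
                       PhiBound (K * (1ℚ + 6^ k) * (1ℚ + 6^ k)) (Cov (compose f₁ sizes gs) (compose f₂ sizes gs))
                                (W1 (compose f₁ sizes gs) (compose f₂ sizes gs))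
    PhiBound-compose {K} 0<K inc₁ inc₂ bound =
      subst (λ c → PhiBound (K * (1ℚ + 6^ k) * (1ℚ + 6^ k)) c (W1 (compose f₁ sizes gs) (compose f₂ sizes gs)))
            (sym (Cov-compose sizes gs WMAtMost⇒Balanced f₁ f₂))
        (PhiBound-transfer 0<K 0<6^k 0≤w̃ W1-compose≤W1 (W1-pair≤1 f₁ f₂ inc₁ inc₂)
           (≤-trans W1≤6^*W1-compose (*-monoʳ-≤-0≤ 0≤w̃ 6^k≤1+6^k)) bound)
      where
      0≤w̃ : 0ℚ ≤ W1 (compose f₁ sizes gs) (compose f₂ sizes gs)
      0≤w̃ = 0≤W1 (compose f₁ sizes gs) (compose f₂ sizes gs)
      0<6^k : 0ℚ < 6^ k
      0<6^k = <-≤-trans (positive⁻¹ 1ℚ) (1≤6^ k)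
      6^k≤1+6^k : 6^ k ≤ 1ℚ + 6^ k
      6^k≤1+6^k = subst (_≤ 1ℚ + 6^ k) (+-identityˡ (6^ k)) (+-monoˡ-≤ (6^ k) (nonNegative⁻¹ 1ℚ))

mainTheorem10 : (k : ℕ) (K : ℚ) → 0ℚ < K →
    Σ ℚ λ K′ → 0ℚ < K′ ×
    ((n : ℕ) (f₁ f₂ : BoolFun n) → Increasing f₁ → Increasing f₂ →
    PhiBound K (Cov f₁ f₂) (W1 f₁ f₂) →
    (sizes : Vec ℕ n) (gs : (i : Fin n) → BoolFun (lookup sizes i)) →
    (∀ i → WMAtMost k (lookup sizes i) (gs i)) →
    PhiBound K′ (Cov (compose f₁ sizes gs) (compose f₂ sizes gs))
    (W1 (compose f₁ sizes gs) (compose f₂ sizes gs)))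
mainTheorem10 k K 0<K = K * (1ℚ + 6^ k) * (1ℚ + 6^ k) , 0<p*q (0<p*q 0<K 0<1+6^k) 0<1+6^k ,
  λ n f₁ f₂ inc₁ inc₂ bound sizes gs wm → PhiBound-compose sizes gs wm f₁ f₂ 0<K inc₁ inc₂ bound
  where
  0<1+6^k : 0ℚ < 1ℚ + 6^ k
  0<1+6^k = +-mono-<-≤ (positive⁻¹ 1ℚ) (≤-trans (nonNegative⁻¹ 1ℚ) (1≤6^ k))
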